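{- Let $m\ge 3$ be odd, $n\ge 6$ even, $n_1=n/2$, $n_0=n_1-1$. Let $(a_1,\dots,a_{n_0})$ be one of the sequences (1) $a_k=mn-n_0+k$; (2) $a_k=m(n_1+k)+1$; (3) $a_k=2mk+1$ (for $1\le k\le n_0$). Then $G(a_1,\dots,a_{n_0})$ has at least $2^m$ distinct $(a_1,\dots,a_{n_0})$-admissible path partitions, and for each such partition $K$ there exist $(m-1)!$ pairwise Klein bottle nonequivalent $C_4$-face-magic Klein bottle labelings $X$ of $\mathcal{K}_{m,n}$ with $\mathcal{L}(X)=K$.
   Context: $\mathcal{K}_{m,n}$: vertex set $\{(i,j):1\le i\le m,1\le j\le n\}$, edges $(i,j)(i,j+1)$ ($j\le n-1$), $(i,n)(i,1)$, $(i,j)(i+1,j)$ ($i\le m-1$), $(m,j)(1,n+1-j)$. Its $4$-cycle faces (column indices mod $n$): $\{(i,j),(i,j+1),(i+1,j),(i+1,j+1)\}$, $1\le i\le m-1$, and $\{(m,j),(m,j+1),(1,n+1-j),(1,n-j)\}$. A $C_4$-face-magic Klein bottle labeling is a bijection $(i,j)\mapsto x_{i,j}$ onto $\{1,\dots,mn\}$ with all these face sums equal. Equivalence: with $U(i,j)=(i+1,j)$ ($i<m$), $U(m,j)=(1,n+1-j)$, $H(i,j)=(i,j+n/2)$ (mod $n$), $F(i,j)=(i,n+1-j)$, $KBLS(m,n)=\langle U,H,F\rangle$; labelings $X,X'$ are Klein bottle equivalent if $X'=\{x_{A(i,j)}\}$ for some $A\in KBLS(m,n)$. $G(a_1,\dots,a_{n_0})$: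 vertex set $\{\{q,mn+1-q\}:1\le q\le mn/2\}$; distinct vertices $\{x_1,x_2\},\{y_1,y_2\}$ are adjacent iff $z_1+z_2=a_j$ for some $z_1\in\{x_1,x_2\}$, $z_2\in\{y_1,y_2\}$, $1\le j\le n_0$. A path on $n_1$ distinct vertices $V_1,\dots,V_{n_1}$ (in order) is $(a_1,\dots,a_{n_0})$-admissible if there are $z_j\in V_j$ with $z_j+z_{j+1}=a_j$ for $1\le j\le n_0$. An admissible path partition is a spanning subgraph that is a disjoint union of $m$ distinct admissible paths. For a $C_4$-face-magic labeling $X$, $\mathcal{L}(X)$ is the graph on the same vertex set with edges between $\{x_{2i-1,j},mn+1-x_{2i-1,j}\}$ and $\{x_{2i-1,j+1},mn+1-x_{2i-1,j+1}\}$ for $1\le i\le(m+1)/2$, $1\le j\le n_0$, and between $\{x_{2i,n+1-j},mn+1-x_{2i,n+1-j}\}$ and $\{x_{2i,n-j},mn+1-x_{2i,n-j}\}$ for $1\le i\le(m-1)/2$, $1\le j\le n_0$. -}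

module Defs where

open import Data.Nat using (ℕ; zero; suc; _+_; _*_; _∸_; _≤_; _<_; _<ᵇ_; _⊓_; ⌊_/2⌋)
open import Data.Nat.DivMod using (_%_)
open import Data.Bool using (if_then_else_)
open import Data.Product using (Σ; _×_; _,_; ∃; uncurry)
open import Data.Sum using (_⊎_)
open import Relation.Binary.PropositionalEquality using (_≡_)
open import Relation.Nullary using (¬_)

-- Conventions: all indices are 1-based natural numbers, exactly as in
-- the paper.  Rows i ∈ {1..m}, columns j ∈ {1..n}.

-- Reduction of a column index "mod n" into the range {1..n}
-- (used for j+1, n+1-j, n-j, j+n/2, which lie in {0..2n}).
cyc : ℕ → ℕ → ℕ
cyc zero k = k
cyc (suc n') k = suc ((k + n') % suc n')

InV : ℕ → ℕ → ℕ → ℕ → Set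
InV m n i j = (1 ≤ i × i ≤ m) × (1 ≤ j × j ≤ n)

-- A labeling assigns a label x_{i,j} to each vertex (values outside the
-- vertex set are irrelevant).
Labeling : Set
Labeling = ℕ → ℕ → ℕ

IsKBLabeling : ℕ → ℕ → Labeling → Set
IsKBLabeling m n X =
  (∀ i j → InV m n i j → 1 ≤ X i j × X i j ≤ m * n)
  × (∀ i j i' j' → InV m n i j → InV m n i' j' → X i j ≡ X i' j' → (i ≡ i' × j ≡ j'))
  × (∀ q → 1 ≤ q → q ≤ m * n → Σ ℕ λ i → Σ ℕ λ j → InV m n i j × X i j ≡ q)

C4FaceMagic : ℕ → ℕ → Labeling → Set
C4FaceMagic m n X = Σ ℕ λ s →
  (∀ i j → 1 ≤ i → i ≤ m ∸ 1 → 1 ≤ j → j ≤ n →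
     X i j + X i (cyc n (suc j)) + X (suc i) j + X (suc i) (cyc n (suc j)) ≡ s)
  × (∀ j → 1 ≤ j → j ≤ n →
     X m j + X m (cyc n (suc j)) + X 1 (cyc n (suc n ∸ j)) + X 1 (cyc n (n ∸ j)) ≡ s)

C4FaceMagicKBLabeling : ℕ → ℕ → Labeling → Set
C4FaceMagicKBLabeling m n X = IsKBLabeling m n X × C4FaceMagic m n X

-- The group KBLS(m,n) = ⟨U,H,F⟩, represented by words in the generators
-- and their inverses (H and F are involutions).

Uₖ : ℕ → ℕ → ℕ × ℕ → ℕ × ℕ
Uₖ m n (i , j) = if i <ᵇ m then (suc i , j) else (1 , cyc n (suc n ∸ j))

U⁻¹ₖ : ℕ → ℕ → ℕ × ℕ → ℕ × ℕ
U⁻¹ₖ m n (i , j) = if 1 <ᵇ i then (i ∸ 1 , j) else (m , cyc n (suc n ∸ j))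

Hₖ : ℕ → ℕ → ℕ × ℕ → ℕ × ℕ
Hₖ m n (i , j) = (i , cyc n (j + ⌊ n /2⌋))

Fₖ : ℕ → ℕ → ℕ × ℕ → ℕ × ℕ
Fₖ m n (i , j) = (i , cyc n (suc n ∸ j))

data KBWord : Set where
  ε   : KBWord
  u   : KBWord → KBWord
  u⁻¹ : KBWord → KBWord
  h   : KBWord → KBWord
  f   : KBWord → KBWord

act : ℕ → ℕ → KBWord → ℕ × ℕ → ℕ × ℕ
act m n ε     p = p
act m n (u w)   p = Uₖ m n (act m n w p)
act m n (u⁻¹ w) p = U⁻¹ₖ m n (act m n w p)
act m n (h w)   p = Hₖ m n (act m n w p)
act m n (f w)   p = Fₖ m n (act m n w p)

KBEquivalent : ℕ → ℕ → Labeling → Labeling → Set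
KBEquivalent m n X X' =
  Σ KBWord λ w → ∀ i j → InV m n i j → X' i j ≡ uncurry X (act m n w (i , j))

-- The graph G(a_1..a_{n0}).  The vertex {q, mn+1-q} (1 ≤ q ≤ mn/2) is
-- represented by q, its smaller element.

GVert : ℕ → ℕ → ℕ → Set
GVert m n q = 1 ≤ q × q ≤ ⌊ m * n /2⌋

InPair : ℕ → ℕ → ℕ → ℕ → Set
InPair m n q z = z ≡ q ⊎ z ≡ suc (m * n) ∸ q

rep : ℕ → ℕ → ℕ → ℕ
rep m n x = x ⊓ (suc (m * n) ∸ x)

Graph : Set₁
Graph = ℕ → ℕ → Set

UEdge : ℕ → ℕ → ℕ → ℕ → Set
UEdge p q a b = (p ≡ a × q ≡ b) ⊎ (p ≡ b × q ≡ a)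

GAdj : ℕ → ℕ → ℕ → (ℕ → ℕ) → ℕ → ℕ → Set
GAdj m n n0 a p q = ¬ (p ≡ q) × Σ ℕ λ z₁ → Σ ℕ λ z₂ → Σ ℕ λ k →
  InPair m n p z₁ × InPair m n q z₂ × (1 ≤ k × k ≤ n0) × z₁ + z₂ ≡ a k

SameGraph : ℕ → ℕ → Graph → Graph → Set
SameGraph m n E E' = ∀ p q → GVert m n p → GVert m n q →
  (E p q → E' p q) × (E' p q → E p q)

AdmissiblePath : ℕ → ℕ → ℕ → (ℕ → ℕ) → (ℕ → ℕ) → Set
AdmissiblePath m n n1 a P =
  (∀ j → 1 ≤ j → j ≤ n1 → GVert m n (P j))
  × (∀ j j' → 1 ≤ j → j ≤ n1 → 1 ≤ j' → j' ≤ n1 → P j ≡ P j' → j ≡ j')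
  × Σ (ℕ → ℕ) λ z →
      (∀ j → 1 ≤ j → j ≤ n1 → InPair m n (P j) (z j))
      × (∀ j → 1 ≤ j → j ≤ n1 ∸ 1 → z j + z (suc j) ≡ a j)

-- K is an (a_1..a_{n0})-admissible path partition of G(a_1..a_{n0}):
-- a spanning subgraph of G which is the disjoint union of m distinct
-- admissible paths P k (1 ≤ k ≤ m), P k j being the j-th vertex of path k.
AdmPathPartition : ℕ → ℕ → (ℕ → ℕ) → Graph → Set
AdmPathPartition m n a K = Σ (ℕ → ℕ → ℕ) λ P →
  (∀ k → 1 ≤ k → k ≤ m → AdmissiblePath m n n1 a (P k))
  × (∀ k k' j j' → 1 ≤ k → k ≤ m → 1 ≤ k' → k' ≤ m →
       1 ≤ j → j ≤ n1 → 1 ≤ j' → j' ≤ n1 → P k j ≡ P k' j' → k ≡ k')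
  × (∀ q → GVert m n q →
       Σ ℕ λ k → Σ ℕ λ j → (1 ≤ k × k ≤ m) × (1 ≤ j × j ≤ n1) × P k j ≡ q)
  × (∀ p q → GVert m n p → GVert m n q → K p q → GAdj m n (n1 ∸ 1) a p q)
  × (∀ p q → GVert m n p → GVert m n q →
       (K p q → Σ ℕ λ k → Σ ℕ λ j → (1 ≤ k × k ≤ m) × (1 ≤ j × j ≤ n1 ∸ 1)
                 × UEdge p q (P k j) (P k (suc j)))
       × ((Σ ℕ λ k → Σ ℕ λ j → (1 ≤ k × k ≤ m) × (1 ≤ j × j ≤ n1 ∸ 1)
                 × UEdge p q (P k j) (P k (suc j))) → K p q))
  where
  n1 = ⌊ n /2⌋

LGraph : ℕ → ℕ → Labeling → Graph
LGraph m n X p q =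
  (Σ ℕ λ i → Σ ℕ λ j → (1 ≤ i × i ≤ ⌊ suc m /2⌋) × (1 ≤ j × j ≤ n0)
     × UEdge p q (rep m n (X (2 * i ∸ 1) j)) (rep m n (X (2 * i ∸ 1) (suc j))))
  ⊎ (Σ ℕ λ i → Σ ℕ λ j → (1 ≤ i × i ≤ ⌊ m ∸ 1 /2⌋) × (1 ≤ j × j ≤ n0)
     × UEdge p q (rep m n (X (2 * i) (suc n ∸ j))) (rep m n (X (2 * i) (n ∸ j))))
  where
  n0 = ⌊ n /2⌋ ∸ 1

data SeqChoice : Set where
  seq1 seq2 seq3 : SeqChoice

seqA : ℕ → ℕ → SeqChoice → ℕ → ℕ
seqA m n seq1 k = m * n ∸ (⌊ n /2⌋ ∸ 1) + k
seqA m n seq2 k = m * (⌊ n /2⌋ + k) + 1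
seqA m n seq3 k = 2 * m * k + 1

module Submission where

-- For each of the three sequences there is an explicit partition of G into m paths
-- whose witnesses alternate between an arithmetic progression c_k + d·t and partners
-- mn + 1 - (c_k + d·t'), so that consecutive sums are exactly a_1, …, a_n0.  Since a is arithmetic
-- with a_n0 + d = mn + 1, swapping the positions (1 2)(3 4)… of any set of paths gives another
-- admissible partition, and the edge between the 2nd and 3rd vertex of path k survives exactly
-- when path k is not swapped: 2^m distinct partitions.
--
-- Given a partition into paths P_1, …, P_m and a permutation σ of the rows fixing m,
-- row i lists the witnesses of P_σ(i) forwards on the left half and backwards on the right half,
-- replacing x by mn + 1 - x on alternate rows and halves.  Each face then consists of two pairs
-- with equal sums oriented oppositely, or of two complementary pairs, so every face sum is
-- 2(mn + 1), and 𝓛(X) = K.  A Klein bottle symmetry acts on row indices as a rotation, so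
-- equivalent labelings with σ(m) = σ'(m) = m have σ = σ': there are (m - 1)! of them.

open import Defs
open import Data.Nat
open import Data.Nat.Properties
open import Data.Nat.DivMod
open import Data.Nat.Tactic.RingSolver
open import Data.Bool using (Bool; true; false; not; if_then_else_; T; _∧_)
open import Data.Empty using (⊥; ⊥-elim)
open import Data.Fin using (Fin; toℕ)
open import Data.Fin.Properties using (toℕ-injective; toℕ<n)
open import Data.Product using (Σ; _×_; _,_; proj₁; proj₂)
open import Data.Sum using (_⊎_; inj₁; inj₂)
open import Data.Unit using (tt)
open import Relation.Binary.Definitions using (tri<; tri≈; tri>)
open import Relation.Binary.PropositionalEquality
open import Relation.Nullary using (¬_; yes; no)

isOdd : ℕ → Bool
isOdd zero = false
isOdd (suc k) = not (isOdd k)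

isOdd-double : ∀ t → isOdd (t + t) ≡ false
isOdd-double zero = refl
isOdd-double (suc t) rewrite +-suc t t | isOdd-double t = refl

isOdd-suc-double : ∀ t → isOdd (suc (t + t)) ≡ true
isOdd-suc-double t rewrite isOdd-double t = refl

⌊n+n/2⌋≡n : ∀ t → ⌊ t + t /2⌋ ≡ t
⌊n+n/2⌋≡n t = sym (n≡⌊n+n/2⌋ t)

⌊1+n+n/2⌋≡n : ∀ t → ⌊ suc (t + t) /2⌋ ≡ t
⌊1+n+n/2⌋≡n zero = refl
⌊1+n+n/2⌋≡n (suc t) rewrite +-suc t t = cong suc (⌊1+n+n/2⌋≡n t)

data ParityView (j : ℕ) : Set where
  odd  : (t : ℕ) → j ≡ suc (t + t) → ParityView j
  even : (t : ℕ) → j ≡ t + t → ParityView j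

parityView : ∀ j → ParityView j
parityView zero = even 0 refl
parityView (suc j) with parityView j
... | odd t e = even (suc t) (trans (cong suc e) (sym (+-suc (suc t) t)))
... | even t e = odd t (cong suc e)

n+n≢1+m+m : ∀ x y → x + x ≢ suc (y + y)
n+n≢1+m+m zero y ()
n+n≢1+m+m (suc x) zero e rewrite +-suc x x with e
... | ()
n+n≢1+m+m (suc x) (suc y) e rewrite +-suc x x | +-suc y y =
  n+n≢1+m+m x y (suc-injective (suc-injective e))

[n+n]%2≡0 : ∀ t → (t + t) % 2 ≡ 0
[n+n]%2≡0 t = trans (cong (_% 2) (double t)) (m*n%n≡0 t 2)
  where
  double : ∀ x → x + x ≡ x * 2
  double = solve-∀

[1+n+n]%2≡1 : ∀ t → suc (t + t) % 2 ≡ 1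
[1+n+n]%2≡1 t = trans (cong (_% 2) (double t)) ([m+kn]%n≡m%n 1 t 2)
  where
  double : ∀ x → suc (x + x) ≡ 1 + x * 2
  double = solve-∀

digits-unique : ∀ w b b' x x' → b < w → b' < w → b + w * x ≡ b' + w * x' → b ≡ b' × x ≡ x'
digits-unique (suc w) b b' x x' b< b'< eq = b≡b' , x≡x'
  where
  low : ∀ c y → c < suc w → (c + suc w * y) % suc w ≡ c
  low c y c< = trans (cong (λ z → (c + z) % suc w) (*-comm (suc w) y))
                     (trans ([m+kn]%n≡m%n c y (suc w)) (m<n⇒m%n≡m c<))
  b≡b' : b ≡ b'
  b≡b' = trans (sym (low b x b<)) (trans (cong (_% suc w) eq) (low b' x' b'<))
  x≡x' : x ≡ x'
  x≡x' = *-cancelˡ-≡ x x' (suc w) (+-cancelˡ-≡ b _ _ (trans eq (cong (_+ suc w * x') (sym b≡b'))))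

suc-∸1 : ∀ {x} → 1 ≤ x → suc (x ∸ 1) ≡ x
suc-∸1 (s≤s _) = refl

≤ᵇ-true : ∀ j k → j ≤ k → (j ≤ᵇ k) ≡ true
≤ᵇ-true j k p with j ≤ᵇ k in eq
... | true = refl
... | false = ⊥-elim (subst T eq (≤⇒≤ᵇ p))

≤ᵇ-false : ∀ j k → k < j → (j ≤ᵇ k) ≡ false
≤ᵇ-false j k p with j ≤ᵇ k in eq
... | false = refl
... | true = ⊥-elim (<⇒≱ p (≤ᵇ⇒≤ j k (subst T (sym eq) tt)))

<ᵇ-true : ∀ j k → j < k → (j <ᵇ k) ≡ true
<ᵇ-true j k p with j <ᵇ k in eq
... | true = refl
... | false = ⊥-elim (subst T eq (<⇒<ᵇ p))

<ᵇ-false : ∀ j k → k ≤ j → (j <ᵇ k) ≡ false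
<ᵇ-false j k p with j <ᵇ k in eq
... | false = refl
... | true = ⊥-elim (<⇒≱ (<ᵇ⇒< j k (subst T (sym eq) tt)) p)

cyc-id : ∀ n k → 1 ≤ k → k ≤ n → cyc n k ≡ k
cyc-id (suc n') (suc k') _ (s≤s k'≤n') =
  cong suc (trans (cong (_% suc n') (sym (+-suc k' n')))
                  (trans ([m+n]%n≡m%n k' (suc n')) (m≤n⇒m%n≡m k'≤n')))

cyc-0 : ∀ n → 1 ≤ n → cyc n 0 ≡ n
cyc-0 (suc n') _ = cong suc (m≤n⇒m%n≡m ≤-refl)

cyc-1+n : ∀ n → 1 ≤ n → cyc n (suc n) ≡ 1
cyc-1+n (suc n') _ =
  cong suc (trans (cong (_% suc n') (shift n')) (trans ([m+n]%n≡m%n (suc n') (suc n')) (n%n≡0 (suc n'))))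
  where
  shift : ∀ x → suc (suc x) + x ≡ suc x + suc x
  shift = solve-∀

cyc-range : ∀ n k → 1 ≤ n → 1 ≤ cyc n k × cyc n k ≤ n
cyc-range (suc n') k _ = s≤s z≤n , s≤s (≤-pred (m%n<n (k + n') (suc n')))

⌊n/2⌋+⌊n/2⌋≤n : ∀ x → ⌊ x /2⌋ + ⌊ x /2⌋ ≤ x
⌊n/2⌋+⌊n/2⌋≤n x = subst (⌊ x /2⌋ + ⌊ x /2⌋ ≤_) (⌊n/2⌋+⌈n/2⌉≡n x) (+-monoʳ-≤ ⌊ x /2⌋ (⌊n/2⌋≤⌈n/2⌉ x))

2*n≡n+n : ∀ i → 2 * i ≡ i + i
2*n≡n+n i = cong (i +_) (+-identityʳ i)

≤⌊/2⌋⇒double≤ : ∀ i x → i ≤ ⌊ x /2⌋ → i + i ≤ x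
≤⌊/2⌋⇒double≤ i x p = ≤-trans (+-mono-≤ p p) (⌊n/2⌋+⌊n/2⌋≤n x)

double≤⇒≤⌊/2⌋ : ∀ i x → i + i ≤ x → i ≤ ⌊ x /2⌋
double≤⇒≤⌊/2⌋ i x p = subst (_≤ ⌊ x /2⌋) (⌊n+n/2⌋≡n i) (⌊n/2⌋-mono p)

2*[1+t]∸1≡1+t+t : ∀ t → 2 * suc t ∸ 1 ≡ suc (t + t)
2*[1+t]∸1≡1+t+t t = trans (cong (_∸ 1) (2*n≡n+n (suc t))) (+-suc t t)

2*i∸1-bounds : ∀ i x → 1 ≤ i → i ≤ ⌊ suc x /2⌋ → 1 ≤ 2 * i ∸ 1 × 2 * i ∸ 1 ≤ x
2*i∸1-bounds (suc t) x _ le =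
  subst (λ z → 1 ≤ z × z ≤ x) (sym (2*[1+t]∸1≡1+t+t t)) (s≤s z≤n , lt)
  where
  lt : suc (t + t) ≤ x
  lt = ≤-pred (subst (_≤ suc x) (cong suc (+-suc t t)) (≤⌊/2⌋⇒double≤ (suc t) (suc x) le))

2*i-bounds : ∀ i x → 1 ≤ i → i ≤ ⌊ x /2⌋ → 1 ≤ 2 * i × 2 * i ≤ x
2*i-bounds (suc t) x _ le = s≤s z≤n , subst (_≤ x) (sym (2*n≡n+n (suc t))) (≤⌊/2⌋⇒double≤ (suc t) x le)

injective⇒surjective-< : ∀ n (g : ℕ → ℕ) → (∀ x → x < n → g x < n) →
  (∀ x y → x < n → y < n → g x ≡ g y → x ≡ y) →
  ∀ y → y < n → Σ ℕ λ x → x < n × g x ≡ y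
injective⇒surjective-< zero g range inj y ()
injective⇒surjective-< (suc n) g range inj y y< with y ≟ g n
... | yes y≡gn = n , ≤-refl , sym y≡gn
... | no y≢gn = found
  where
  g' : ℕ → ℕ
  g' x with g x ≟ n
  ... | yes _ = g n
  ... | no _ = g x
  lower : ∀ z → z < suc n → z ≢ n → z < n
  lower z z< z≢ = ≤∧≢⇒< (≤-pred z<) z≢
  gn≢n : ∀ x → x < n → g x ≡ n → g n ≢ n
  gn≢n x x< gx≡n gn≡n = <⇒≢ x< (inj x n (m≤n⇒m≤1+n x<) ≤-refl (trans gx≡n (sym gn≡n)))
  g'-range : ∀ x → x < n → g' x < n
  g'-range x x< with g x ≟ n
  ... | yes e = lower (g n) (range n ≤-refl) (gn≢n x x< e)
  ... | no e = lower (g x) (range x (m≤n⇒m≤1+n x<)) e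
  g'-inj : ∀ x x' → x < n → x' < n → g' x ≡ g' x' → x ≡ x'
  g'-inj x x' x< x'< e with g x ≟ n | g x' ≟ n
  ... | yes ex | yes ex' = inj x x' (m≤n⇒m≤1+n x<) (m≤n⇒m≤1+n x'<) (trans ex (sym ex'))
  ... | yes _ | no _ = ⊥-elim (<⇒≢ x'< (sym (inj n x' ≤-refl (m≤n⇒m≤1+n x'<) e)))
  ... | no _ | yes _ = ⊥-elim (<⇒≢ x< (inj x n (m≤n⇒m≤1+n x<) ≤-refl e))
  ... | no _ | no _ = inj x x' (m≤n⇒m≤1+n x<) (m≤n⇒m≤1+n x'<) e
  found : Σ ℕ λ x → x < suc n × g x ≡ y
  found with y ≟ n
  ... | yes y≡n with injective⇒surjective-< n g' g'-range g'-inj (g n)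
                       (lower (g n) (range n ≤-refl) (λ e → y≢gn (trans y≡n (sym e))))
  ...   | x , x< , g'x with g x ≟ n
  ...     | yes e = x , m≤n⇒m≤1+n x< , trans e (sym y≡n)
  ...     | no _ = ⊥-elim (<⇒≢ x< (inj x n (m≤n⇒m≤1+n x<) ≤-refl g'x))
  found | no y≢n with injective⇒surjective-< n g' g'-range g'-inj y (lower y y< y≢n)
  ... | x , x< , g'x with g x ≟ n
  ...   | yes _ = ⊥-elim (y≢gn (sym g'x))
  ...   | no _ = x , m≤n⇒m≤1+n x< , g'x

bit : ℕ → ℕ → Bool
bit T zero = false
bit T (suc zero) = T % 2 ≡ᵇ 1
bit T (suc (suc k)) = bit (T / 2) (suc k)

bits-determine-code : ∀ m T T' → T < 2 ^ m → T' < 2 ^ m →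
  (∀ k → 1 ≤ k → k ≤ m → bit T k ≡ bit T' k) → T ≡ T'
bits-determine-code zero zero zero _ _ _ = refl
bits-determine-code zero (suc T) _ (s≤s ()) _ _
bits-determine-code zero zero (suc T') _ (s≤s ()) _
bits-determine-code (suc m) T T' T< T'< same =
  begin
    T                     ≡⟨ m≡m%n+[m/n]*n T 2 ⟩
    T % 2 + (T / 2) * 2   ≡⟨ cong₂ (λ r q → r + q * 2) lowest higher ⟩
    T' % 2 + (T' / 2) * 2 ≡⟨ sym (m≡m%n+[m/n]*n T' 2) ⟩
    T'                    ∎
  where
  open ≡-Reasoning
  digit : ∀ x y → x < 2 → y < 2 → (x ≡ᵇ 1) ≡ (y ≡ᵇ 1) → x ≡ y
  digit zero zero _ _ _ = refl
  digit (suc zero) (suc zero) _ _ _ = refl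
  digit zero (suc zero) _ _ ()
  digit (suc zero) zero _ _ ()
  digit (suc (suc _)) _ (s≤s (s≤s ())) _ _
  digit _ (suc (suc _)) _ (s≤s (s≤s ())) _
  lowest : T % 2 ≡ T' % 2
  lowest = digit _ _ (m%n<n T 2) (m%n<n T' 2) (same 1 (s≤s z≤n) (s≤s z≤n))
  halve< : ∀ U → U < 2 ^ suc m → U / 2 < 2 ^ m
  halve< U U< = m<n*o⇒m/o<n (subst (U <_) (*-comm 2 (2 ^ m)) U<)
  higher : T / 2 ≡ T' / 2
  higher = bits-determine-code m (T / 2) (T' / 2) (halve< T T<) (halve< T' T'<) same-higher
    where
    same-higher : ∀ k → 1 ≤ k → k ≤ m → bit (T / 2) k ≡ bit (T' / 2) k
    same-higher (suc k) _ k≤m = same (suc (suc k)) (s≤s z≤n) (s≤s k≤m)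

transpose : ℕ → ℕ → ℕ → ℕ
transpose a b x with x ≟ a
... | yes _ = b
... | no _ with x ≟ b
...   | yes _ = a
...   | no _ = x

transpose-left : ∀ a b → transpose a b a ≡ b
transpose-left a b with a ≟ a
... | yes _ = refl
... | no a≢a = ⊥-elim (a≢a refl)

transpose-right : ∀ a b → transpose a b b ≡ a
transpose-right a b with b ≟ a
... | yes b≡a = b≡a
... | no _ with b ≟ b
...   | yes _ = refl
...   | no b≢b = ⊥-elim (b≢b refl)

transpose-other : ∀ a b x → x ≢ a → x ≢ b → transpose a b x ≡ x
transpose-other a b x x≢a x≢b with x ≟ a
... | yes x≡a = ⊥-elim (x≢a x≡a)
... | no _ with x ≟ b
...   | yes x≡b = ⊥-elim (x≢b x≡b)
...   | no _ = refl

transpose-involutive : ∀ a b x → transpose a b (transpose a b x) ≡ x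
transpose-involutive a b x with x ≟ a
... | yes x≡a = trans (transpose-right a b) (sym x≡a)
... | no x≢a with x ≟ b
...   | yes x≡b = trans (transpose-left a b) (sym x≡b)
...   | no x≢b = transpose-other a b x x≢a x≢b

transpose-injective : ∀ a b x y → transpose a b x ≡ transpose a b y → x ≡ y
transpose-injective a b x y e =
  trans (sym (transpose-involutive a b x)) (trans (cong (transpose a b) e) (transpose-involutive a b y))

transpose-range : ∀ K a b x → 1 ≤ a → a ≤ K → 1 ≤ b → b ≤ K → 1 ≤ x → x ≤ K →
  1 ≤ transpose a b x × transpose a b x ≤ K
transpose-range K a b x a1 aK b1 bK x1 xK with x ≟ a
... | yes _ = b1 , bK
... | no _ with x ≟ b
...   | yes _ = a1 , aK
...   | no _ = x1 , xK

decodePerm : ℕ → ℕ → ℕ → ℕ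
decodePerm zero T x = x
decodePerm (suc k) T x = transpose (suc k) (suc (T % suc k)) (decodePerm k (T / suc k) x)

decodePerm-fixes : ∀ k T x → k < x → decodePerm k T x ≡ x
decodePerm-fixes zero T x _ = refl
decodePerm-fixes (suc k) T x k< rewrite decodePerm-fixes k (T / suc k) x (<-trans (n<1+n k) k<) =
  transpose-other _ _ x (λ e → <⇒≢ k< (sym e)) (λ e → <⇒≢ (≤-<-trans (m%n<n T (suc k)) k<) (sym e))

decodePerm-range : ∀ K k T x → k ≤ K → 1 ≤ x → x ≤ K → 1 ≤ decodePerm k T x × decodePerm k T x ≤ K
decodePerm-range K zero T x _ x1 xK = x1 , xK
decodePerm-range K (suc k) T x k≤K x1 xK with decodePerm-range K k (T / suc k) x (≤-trans (n≤1+n k) k≤K) x1 xK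
... | p1 , pK = transpose-range K _ _ _ (s≤s z≤n) k≤K (s≤s z≤n) (≤-trans (m%n<n T (suc k)) k≤K) p1 pK

decodePerm-injective : ∀ k T x y → decodePerm k T x ≡ decodePerm k T y → x ≡ y
decodePerm-injective zero T x y e = e
decodePerm-injective (suc k) T x y e = decodePerm-injective k (T / suc k) x y (transpose-injective _ _ _ _ e)

decodePerm-surjective : ∀ K k T y → k ≤ K → 1 ≤ y → y ≤ K →
  Σ ℕ λ x → (1 ≤ x × x ≤ K) × decodePerm k T x ≡ y
decodePerm-surjective K zero T y _ y1 yK = y , (y1 , yK) , refl
decodePerm-surjective K (suc k) T y k≤K y1 yK
  with decodePerm-surjective K k (T / suc k) (transpose a b y) (≤-trans (n≤1+n k) k≤K)
         (proj₁ y'-range) (proj₂ y'-range)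
  where
  a = suc k
  b = suc (T % suc k)
  y'-range = transpose-range K a b y (s≤s z≤n) k≤K (s≤s z≤n) (≤-trans (m%n<n T (suc k)) k≤K) y1 yK
... | x , x-range , e = x , x-range , trans (cong (transpose _ _) e) (transpose-involutive _ _ y)

decodePerm-determines-code : ∀ k T T' → T < k ! → T' < k ! →
  (∀ x → 1 ≤ x → x ≤ k → decodePerm k T x ≡ decodePerm k T' x) → T ≡ T'
decodePerm-determines-code zero zero zero _ _ _ = refl
decodePerm-determines-code zero (suc T) _ (s≤s ()) _ _
decodePerm-determines-code zero zero (suc T') _ (s≤s ()) _
decodePerm-determines-code (suc k) T T' T< T'< same =
  begin
    T                                 ≡⟨ m≡m%n+[m/n]*n T (suc k) ⟩
    T % suc k + (T / suc k) * suc k   ≡⟨ cong₂ (λ r q → r + q * suc k) lowest higher ⟩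
    T' % suc k + (T' / suc k) * suc k ≡⟨ sym (m≡m%n+[m/n]*n T' (suc k)) ⟩
    T'                                ∎
  where
  open ≡-Reasoning
  image-of-top : ∀ U → decodePerm (suc k) U (suc k) ≡ suc (U % suc k)
  image-of-top U rewrite decodePerm-fixes k (U / suc k) (suc k) ≤-refl = transpose-left (suc k) (suc (U % suc k))
  lowest : T % suc k ≡ T' % suc k
  lowest = suc-injective (trans (sym (image-of-top T)) (trans (same (suc k) (s≤s z≤n) ≤-refl) (image-of-top T')))
  divide< : ∀ U → U < suc k ! → U / suc k < k !
  divide< U U< = m<n*o⇒m/o<n (subst (U <_) (*-comm (suc k) (k !)) U<)
  higher : T / suc k ≡ T' / suc k
  higher = decodePerm-determines-code k _ _ (divide< T T<) (divide< T' T'<) same-lower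
    where
    same-lower : ∀ x → 1 ≤ x → x ≤ k → decodePerm k (T / suc k) x ≡ decodePerm k (T' / suc k) x
    same-lower x x1 x≤k = transpose-injective (suc k) (suc (T % suc k)) _ _
      (trans (same x x1 (≤-trans x≤k (n≤1+n k)))
             (cong (λ r → transpose (suc k) (suc r) (decodePerm k (T' / suc k) x)) (sym lowest)))

module LabelPairs (m n : ℕ) (m≥3 : 3 ≤ m) (m-odd : m % 2 ≡ 1) (n≥6 : 6 ≤ n) (n-even : n % 2 ≡ 0) where

  n1 : ℕ
  n1 = ⌊ n /2⌋

  N : ℕ
  N = m * n

  H : ℕ
  H = m * n1

  N⁺ : ℕ
  N⁺ = suc N

  n≡n1+n1 : n ≡ n1 + n1
  n≡n1+n1 with parityView n
  ... | odd t e = ⊥-elim (0≢1+n (trans (sym n-even) (trans (cong (_% 2) e) ([1+n+n]%2≡1 t))))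
  ... | even t e = trans e (cong (λ x → x + x) (trans (sym (⌊n+n/2⌋≡n t)) (cong ⌊_/2⌋ (sym e))))

  mh : ℕ
  mh = ⌊ m /2⌋

  m≡1+mh+mh : m ≡ suc (mh + mh)
  m≡1+mh+mh with parityView m
  ... | odd t e = trans e (cong (λ x → suc (x + x)) (trans (sym (⌊1+n+n/2⌋≡n t)) (cong ⌊_/2⌋ (sym e))))
  ... | even t e = ⊥-elim (0≢1+n (trans (sym ([n+n]%2≡0 t)) (trans (cong (_% 2) (sym e)) m-odd)))

  isOdd-m : isOdd m ≡ true
  isOdd-m = trans (cong isOdd m≡1+mh+mh) (isOdd-suc-double mh)

  m≥1 : 1 ≤ m
  m≥1 = ≤-trans (s≤s z≤n) m≥3

  n≥1 : 1 ≤ n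
  n≥1 = ≤-trans (s≤s z≤n) n≥6

  n1≥3 : 3 ≤ n1
  n1≥3 with 3 ≤? n1
  ... | yes p = p
  ... | no ¬p = ⊥-elim (<⇒≱ (s≤s (≤-trans (+-mono-≤ n1≤2 n1≤2) (n≤1+n 4))) (subst (6 ≤_) n≡n1+n1 n≥6))
    where
    n1≤2 : n1 ≤ 2
    n1≤2 = ≤-pred (≰⇒> ¬p)

  n1≥1 : 1 ≤ n1
  n1≥1 = ≤-trans (s≤s z≤n) n1≥3

  n1≤n : n1 ≤ n
  n1≤n = subst (n1 ≤_) (sym n≡n1+n1) (m≤m+n n1 n1)

  suc≤n1 : ∀ {j} → j ≤ n1 ∸ 1 → suc j ≤ n1
  suc≤n1 j≤ = subst (_ ≤_) (suc-∸1 n1≥1) (s≤s j≤)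

  n1<n : n1 < n
  n1<n = subst (n1 <_) (sym n≡n1+n1) (m<m+n n1 n1≥1)

  n∸n1≡n1 : n ∸ n1 ≡ n1
  n∸n1≡n1 = trans (cong (_∸ n1) n≡n1+n1) (m+n∸m≡n n1 n1)

  N≡H+H : N ≡ H + H
  N≡H+H = trans (cong (m *_) n≡n1+n1) (*-distribˡ-+ m n1 n1)

  ⌊N/2⌋≡H : ⌊ N /2⌋ ≡ H
  ⌊N/2⌋≡H = trans (cong ⌊_/2⌋ N≡H+H) (⌊n+n/2⌋≡n H)

  H≤N : H ≤ N
  H≤N = subst (H ≤_) (sym N≡H+H) (m≤m+n H H)

  H≤N⁺ : H ≤ N⁺
  H≤N⁺ = ≤-trans H≤N (n≤1+n N)

  compl : ℕ → ℕ
  compl x = N⁺ ∸ x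

  compl-involutive : ∀ x → x ≤ N⁺ → compl (compl x) ≡ x
  compl-involutive x x≤ = m∸[m∸n]≡n x≤

  orient : Bool → ℕ → ℕ
  orient true w = w
  orient false w = compl w

  GVert⇒bounds : ∀ {p} → GVert m n p → 1 ≤ p × p ≤ H
  GVert⇒bounds {p} (p1 , p≤) = p1 , subst (p ≤_) ⌊N/2⌋≡H p≤

  bounds⇒GVert : ∀ {p} → 1 ≤ p → p ≤ H → GVert m n p
  bounds⇒GVert {p} p1 p≤ = p1 , subst (p ≤_) (sym ⌊N/2⌋≡H) p≤

  GVert⇒≤N⁺ : ∀ {p} → GVert m n p → p ≤ N⁺
  GVert⇒≤N⁺ g = ≤-trans (proj₂ (GVert⇒bounds g)) H≤N⁺

  InPair-range : ∀ {p v} → GVert m n p → InPair m n p v → 1 ≤ v × v ≤ N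
  InPair-range g (inj₁ refl) = proj₁ (GVert⇒bounds g) , ≤-trans (proj₂ (GVert⇒bounds g)) H≤N
  InPair-range {p} g (inj₂ refl) =
    subst (1 ≤_) (sym (+-∸-assoc 1 (≤-trans (proj₂ (GVert⇒bounds g)) H≤N))) (s≤s z≤n) ,
    ∸-monoʳ-≤ N⁺ (proj₁ (GVert⇒bounds g))

  InPair-compl : ∀ {p v} → p ≤ N⁺ → InPair m n p v → InPair m n p (compl v)
  InPair-compl _ (inj₁ refl) = inj₂ refl
  InPair-compl p≤ (inj₂ refl) = inj₁ (compl-involutive _ p≤)

  InPair-orient : ∀ {p v} b → p ≤ N⁺ → InPair m n p v → InPair m n p (orient b v)
  InPair-orient true _ v∈p = v∈p
  InPair-orient false p≤ v∈p = InPair-compl p≤ v∈p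

  InPair-same : ∀ {p v w} → p ≤ N⁺ → InPair m n p v → InPair m n p w → v ≡ w ⊎ v ≡ compl w
  InPair-same _ (inj₁ e) (inj₁ e') = inj₁ (trans e (sym e'))
  InPair-same p≤ (inj₁ e) (inj₂ e') = inj₂ (trans e (trans (sym (compl-involutive _ p≤)) (cong compl (sym e'))))
  InPair-same _ (inj₂ e) (inj₁ e') = inj₂ (trans e (cong compl (sym e')))
  InPair-same _ (inj₂ e) (inj₂ e') = inj₁ (trans e (sym e'))

  GVert-sum≤N : ∀ {p q} → GVert m n p → GVert m n q → p + q ≤ N
  GVert-sum≤N {p} {q} gp gq =
    subst (p + q ≤_) (sym N≡H+H) (+-mono-≤ (proj₂ (GVert⇒bounds gp)) (proj₂ (GVert⇒bounds gq)))

  GVert-not-complementary : ∀ {p q} → GVert m n p → GVert m n q → p ≢ compl q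
  GVert-not-complementary {p} {q} gp gq p≡ =
    <⇒≢ (s≤s (GVert-sum≤N gp gq)) (trans (cong (_+ q) p≡) (m∸n+n≡m (GVert⇒≤N⁺ gq)))

  InPair-unique : ∀ {p p' v} → GVert m n p → GVert m n p' → InPair m n p v → InPair m n p' v → p ≡ p'
  InPair-unique g g' (inj₁ e) (inj₁ e') = trans (sym e) e'
  InPair-unique g g' (inj₁ e) (inj₂ e') = ⊥-elim (GVert-not-complementary g g' (trans (sym e) e'))
  InPair-unique g g' (inj₂ e) (inj₁ e') = ⊥-elim (GVert-not-complementary g' g (trans (sym e') e))
  InPair-unique g g' (inj₂ e) (inj₂ e') = ∸-cancelˡ-≡ (GVert⇒≤N⁺ g) (GVert⇒≤N⁺ g') (trans (sym e) e')

  p≤compl-p : ∀ {p} → GVert m n p → p ≤ compl p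
  p≤compl-p {p} g = subst (_≤ compl p) (m+n∸n≡m p p) (∸-monoˡ-≤ p (≤-trans (GVert-sum≤N g g) (n≤1+n N)))

  rep-InPair : ∀ {p v} → GVert m n p → InPair m n p v → rep m n v ≡ p
  rep-InPair g (inj₁ refl) = m≤n⇒m⊓n≡m (p≤compl-p g)
  rep-InPair {p} g (inj₂ refl) =
    trans (cong (compl p ⊓_) (compl-involutive p (GVert⇒≤N⁺ g))) (m≥n⇒m⊓n≡n (p≤compl-p g))

  orient-sum : ∀ b v → v ≤ N⁺ → orient b v + orient (not b) v ≡ N⁺
  orient-sum true v v≤ = m+[n∸m]≡n v≤
  orient-sum false v v≤ = m∸n+n≡m v≤

  orient-sum' : ∀ b v → v ≤ N⁺ → orient (not b) v + orient b v ≡ N⁺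
  orient-sum' b v v≤ = trans (+-comm (orient (not b) v) (orient b v)) (orient-sum b v v≤)

  -- N⁺ = 2H + 1 is odd, so no label is its own partner.
  x≢compl-x : ∀ x → x ≢ compl x
  x≢compl-x x e = n+n≢1+m+m x H (trans (cong (x +_) e) (trans (m+[n∸m]≡n x≤N⁺) (cong suc N≡H+H)))
    where
    x≤N⁺ : x ≤ N⁺
    x≤N⁺ with x ≤? N⁺
    ... | yes p = p
    ... | no ¬p = ⊥-elim (¬p (subst (_≤ N⁺) (sym (trans e (m≤n⇒m∸n≡0 (≤-trans (n≤1+n N⁺) (≰⇒> ¬p))))) z≤n))

  orient-≢ : ∀ b v → orient b v ≢ orient (not b) v
  orient-≢ true v e = x≢compl-x v e
  orient-≢ false v e = x≢compl-x v (sym e)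

  label-vertex : ∀ q → 1 ≤ q → q ≤ N → Σ ℕ λ p → GVert m n p × InPair m n p q
  label-vertex q q1 q≤N with q ≤? H
  ... | yes q≤H = q , bounds⇒GVert q1 q≤H , inj₁ refl
  ... | no q≰H = compl q , bounds⇒GVert compl-q≥1 compl-q≤H , inj₂ (sym (compl-involutive q (≤-trans q≤N (n≤1+n N))))
    where
    compl-q≥1 : 1 ≤ compl q
    compl-q≥1 = subst (1 ≤_) (sym (+-∸-assoc 1 q≤N)) (s≤s z≤n)
    compl-q≤H : compl q ≤ H
    compl-q≤H = subst (compl q ≤_) (m+n∸n≡m H q) (∸-monoˡ-≤ q
                  (subst (_≤ H + q) (trans (+-suc H H) (cong suc (sym N≡H+H))) (+-monoʳ-≤ H (≰⇒> q≰H))))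

  mirror-right : ∀ j → j ≤ n1 → n1 < suc n ∸ j
  mirror-right j j≤n1 =
    subst (_< suc n ∸ j) n∸n1≡n1 (subst (n ∸ n1 <_) (sym (+-∸-assoc 1 (≤-trans j≤n1 n1≤n))) (s≤s (∸-monoʳ-≤ n j≤n1)))

  mirror≤n : ∀ j → 1 ≤ j → suc n ∸ j ≤ n
  mirror≤n (suc j) _ = m∸n≤m n j

  mirror-involutive : ∀ j → j ≤ n → suc n ∸ (suc n ∸ j) ≡ j
  mirror-involutive j j≤n = m∸[m∸n]≡n (≤-trans j≤n (n≤1+n n))

  mirror-of-right : ∀ j → n1 < j → j ≤ n → suc n ∸ j ≡ suc (n ∸ j) × n ∸ j < n1
  mirror-of-right j n1<j j≤n = +-∸-assoc 1 j≤n , subst (n ∸ j <_) n∸n1≡n1 (∸-monoʳ-< n1<j j≤n)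

  face-sum : ∀ b x₁ x₂ y₁ y₂ → x₁ ≤ N⁺ → x₂ ≤ N⁺ → y₁ ≤ N⁺ → y₂ ≤ N⁺ → x₁ + x₂ ≡ y₁ + y₂ →
    orient b x₁ + orient b x₂ + orient (not b) y₁ + orient (not b) y₂ ≡ N⁺ + N⁺
  face-sum true x₁ x₂ y₁ y₂ _ _ y₁≤ y₂≤ e =
    begin
      x₁ + x₂ + compl y₁ + compl y₂         ≡⟨ cong (λ z → z + compl y₁ + compl y₂) e ⟩
      y₁ + y₂ + compl y₁ + compl y₂         ≡⟨ regroup y₁ y₂ (compl y₁) (compl y₂) ⟩
      (y₁ + compl y₁) + (y₂ + compl y₂)     ≡⟨ cong₂ _+_ (m+[n∸m]≡n y₁≤) (m+[n∸m]≡n y₂≤) ⟩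
      N⁺ + N⁺                               ∎
    where
    open ≡-Reasoning
    regroup : ∀ a b c d → a + b + c + d ≡ (a + c) + (b + d)
    regroup = solve-∀
  face-sum false x₁ x₂ y₁ y₂ x₁≤ x₂≤ _ _ e =
    begin
      compl x₁ + compl x₂ + y₁ + y₂         ≡⟨ +-assoc (compl x₁ + compl x₂) y₁ y₂ ⟩
      compl x₁ + compl x₂ + (y₁ + y₂)       ≡⟨ cong (compl x₁ + compl x₂ +_) (sym e) ⟩
      compl x₁ + compl x₂ + (x₁ + x₂)       ≡⟨ regroup x₁ x₂ (compl x₁) (compl x₂) ⟩
      (x₁ + compl x₁) + (x₂ + compl x₂)     ≡⟨ cong₂ _+_ (m+[n∸m]≡n x₁≤) (m+[n∸m]≡n x₂≤) ⟩
      N⁺ + N⁺                               ∎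
    where
    open ≡-Reasoning
    regroup : ∀ a b c d → c + d + (a + b) ≡ (a + c) + (b + d)
    regroup = solve-∀

module RowAction (m n : ℕ) (m≥1 : 1 ≤ m) (n≥1 : 1 ≤ n) where

  rotate : ℕ → ℕ
  rotate i = if i <ᵇ m then suc i else 1

  rotate⁻¹ : ℕ → ℕ
  rotate⁻¹ i = if 1 <ᵇ i then i ∸ 1 else m

  rowAction : KBWord → ℕ → ℕ
  rowAction ε i = i
  rowAction (u w) i = rotate (rowAction w i)
  rowAction (u⁻¹ w) i = rotate⁻¹ (rowAction w i)
  rowAction (h w) i = rowAction w i
  rowAction (f w) i = rowAction w i

  act-row : ∀ w i j → proj₁ (act m n w (i , j)) ≡ rowAction w i
  act-row ε i j = refl
  act-row (u w) i j with act m n w (i , j) | act-row w i j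
  ... | (x , y) | refl with x <ᵇ m
  ... | true = refl
  ... | false = refl
  act-row (u⁻¹ w) i j with act m n w (i , j) | act-row w i j
  ... | (x , y) | refl with 1 <ᵇ x
  ... | true = refl
  ... | false = refl
  act-row (h w) i j = act-row w i j
  act-row (f w) i j = act-row w i j

  act-col-range : ∀ w i j → 1 ≤ j → j ≤ n →
    1 ≤ proj₂ (act m n w (i , j)) × proj₂ (act m n w (i , j)) ≤ n
  act-col-range ε i j j1 jn = j1 , jn
  act-col-range (u w) i j j1 jn with act m n w (i , j) | act-col-range w i j j1 jn
  ... | (x , y) | ih with x <ᵇ m
  ... | true = ih
  ... | false = cyc-range n _ n≥1
  act-col-range (u⁻¹ w) i j j1 jn with act m n w (i , j) | act-col-range w i j j1 jn
  ... | (x , y) | ih with 1 <ᵇ x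
  ... | true = ih
  ... | false = cyc-range n _ n≥1
  act-col-range (h w) i j j1 jn = cyc-range n _ n≥1
  act-col-range (f w) i j j1 jn = cyc-range n _ n≥1

  InRows : ℕ → Set
  InRows x = 1 ≤ x × x ≤ m

  rotate-range : ∀ x → InRows x → InRows (rotate x)
  rotate-range x (x1 , xm) with x <? m
  ... | yes x<m rewrite <ᵇ-true x m x<m = s≤s z≤n , x<m
  ... | no x≮m rewrite <ᵇ-false x m (≮⇒≥ x≮m) = ≤-refl , m≥1

  rotate⁻¹-range : ∀ x → InRows x → InRows (rotate⁻¹ x)
  rotate⁻¹-range x (x1 , xm) with 1 <? x
  ... | yes 1<x rewrite <ᵇ-true 1 x 1<x = m<n⇒0<n∸m 1<x , ≤-trans (m∸n≤m x 1) xm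
  ... | no 1≮x rewrite <ᵇ-false 1 x (≮⇒≥ 1≮x) = m≥1 , ≤-refl

  rotate-m : rotate m ≡ 1
  rotate-m rewrite <ᵇ-false m m ≤-refl = refl

  rotate-rotate⁻¹ : ∀ x → InRows x → rotate (rotate⁻¹ x) ≡ x
  rotate-rotate⁻¹ x (x1 , xm) with 1 <? x
  ... | yes 1<x rewrite <ᵇ-true 1 x 1<x | <ᵇ-true (x ∸ 1) m (subst (_≤ m) (sym (suc-∸1 x1)) xm) = suc-∸1 x1
  ... | no 1≮x rewrite <ᵇ-false 1 x (≮⇒≥ 1≮x) = trans rotate-m (≤-antisym x1 (≮⇒≥ 1≮x))

  rotate⁻¹-rotate : ∀ x → InRows x → rotate⁻¹ (rotate x) ≡ x
  rotate⁻¹-rotate x (x1 , xm) with x <? m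
  ... | yes x<m rewrite <ᵇ-true x m x<m | <ᵇ-true 1 (suc x) (s≤s x1) = refl
  ... | no x≮m rewrite <ᵇ-false x m (≮⇒≥ x≮m) = sym (≤-antisym xm (≮⇒≥ x≮m))

  rowAction-range : ∀ w x → InRows x → InRows (rowAction w x)
  rowAction-range ε x p = p
  rowAction-range (u w) x p = rotate-range _ (rowAction-range w x p)
  rowAction-range (u⁻¹ w) x p = rotate⁻¹-range _ (rowAction-range w x p)
  rowAction-range (h w) x p = rowAction-range w x p
  rowAction-range (f w) x p = rowAction-range w x p

  rowAction-rotate : ∀ w x → InRows x → rowAction w (rotate x) ≡ rotate (rowAction w x)
  rowAction-rotate ε x p = refl
  rowAction-rotate (u w) x p = cong rotate (rowAction-rotate w x p)
  rowAction-rotate (u⁻¹ w) x p =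
    trans (cong rotate⁻¹ (rowAction-rotate w x p))
          (trans (rotate⁻¹-rotate _ (rowAction-range w x p)) (sym (rotate-rotate⁻¹ _ (rowAction-range w x p))))
  rowAction-rotate (h w) x p = rowAction-rotate w x p
  rowAction-rotate (f w) x p = rowAction-rotate w x p

  rotate^ : ℕ → ℕ → ℕ
  rotate^ zero x = x
  rotate^ (suc k) x = rotate (rotate^ k x)

  rotate^-range : ∀ k x → InRows x → InRows (rotate^ k x)
  rotate^-range zero x p = p
  rotate^-range (suc k) x p = rotate-range _ (rotate^-range k x p)

  rowAction-rotate^ : ∀ w k x → InRows x → rowAction w (rotate^ k x) ≡ rotate^ k (rowAction w x)
  rowAction-rotate^ w zero x p = refl
  rowAction-rotate^ w (suc k) x p =
    trans (rowAction-rotate w (rotate^ k x) (rotate^-range k x p)) (cong rotate (rowAction-rotate^ w k x p))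

  rotate^-m : ∀ k → 1 ≤ k → k ≤ m → rotate^ k m ≡ k
  rotate^-m (suc zero) _ _ = rotate-m
  rotate^-m (suc (suc k)) _ k<m rewrite rotate^-m (suc k) (s≤s z≤n) (≤-trans (n≤1+n _) k<m) =
    cong (λ b → if b then suc (suc k) else 1) (<ᵇ-true (suc k) m k<m)

  rowAction-fixing-m : ∀ w → rowAction w m ≡ m → ∀ i → InRows i → rowAction w i ≡ i
  rowAction-fixing-m w fix i (i1 , im) =
    begin
      rowAction w i                ≡⟨ cong (rowAction w) (sym (rotate^-m i i1 im)) ⟩
      rowAction w (rotate^ i m)    ≡⟨ rowAction-rotate^ w i m (m≥1 , ≤-refl) ⟩
      rotate^ i (rowAction w m)    ≡⟨ cong (rotate^ i) fix ⟩
      rotate^ i m                  ≡⟨ rotate^-m i i1 im ⟩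
      i                            ∎
    where
    open ≡-Reasoning

PathEdges : ℕ → ℕ → (ℕ → ℕ → ℕ) → Graph
PathEdges m n1 P p q = Σ ℕ λ k → Σ ℕ λ j → (1 ≤ k × k ≤ m) × (1 ≤ j × j ≤ n1 ∸ 1) × UEdge p q (P k j) (P k (suc j))

SameGraph-trans : ∀ {m n E E' E''} → SameGraph m n E E' → SameGraph m n E' E'' → SameGraph m n E E''
SameGraph-trans E≈E' E'≈E'' p q gp gq =
  (λ e → proj₁ (E'≈E'' p q gp gq) (proj₁ (E≈E' p q gp gq) e)) ,
  (λ e → proj₂ (E≈E' p q gp gq) (proj₂ (E'≈E'' p q gp gq) e))

SameGraph-sym : ∀ {m n E E'} → SameGraph m n E E' → SameGraph m n E' E
SameGraph-sym E≈E' p q gp gq = proj₂ (E≈E' p q gp gq) , proj₁ (E≈E' p q gp gq)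

UEdge-cong : ∀ {p q x y x' y'} → x ≡ x' → y ≡ y' → UEdge p q x y → UEdge p q x' y'
UEdge-cong refl refl e = e

record IsPermutation (m : ℕ) (σ : ℕ → ℕ) : Set where
  field
    range : ∀ x → 1 ≤ x → x ≤ m → 1 ≤ σ x × σ x ≤ m
    injective : ∀ x y → 1 ≤ x → x ≤ m → 1 ≤ y → y ≤ m → σ x ≡ σ y → x ≡ y
    surjective : ∀ y → 1 ≤ y → y ≤ m → Σ ℕ λ x → (1 ≤ x × x ≤ m) × σ x ≡ y

decodePerm-isPermutation : ∀ K k T → k ≤ K → IsPermutation K (decodePerm k T)
decodePerm-isPermutation K k T k≤K = record
  { range = λ x x1 xK → decodePerm-range K k T x k≤K x1 xK
  ; injective = λ x y _ _ _ _ → decodePerm-injective k T x y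
  ; surjective = λ y y1 yK → decodePerm-surjective K k T y k≤K y1 yK
  }

module Labelings (m n : ℕ) (m≥3 : 3 ≤ m) (m-odd : m % 2 ≡ 1) (n≥6 : 6 ≤ n) (n-even : n % 2 ≡ 0)
  (a : ℕ → ℕ) where

  open LabelPairs m n m≥3 m-odd n≥6 n-even
  open RowAction m n m≥1 n≥1

  data Half (j : ℕ) : Set where
    left : j ≤ n1 → Half j
    right : n1 < j → Half j

  half : ∀ j → Half j
  half j with j ≤? n1
  ... | yes j≤n1 = left j≤n1
  ... | no j≰n1 = right (≰⇒> j≰n1)

  -- Column j and its mirror column n+1-j carry the same vertex of the path, at position pos j.
  pos : ℕ → ℕ
  pos j = if j ≤ᵇ n1 then j else suc n ∸ j

  pos-left : ∀ j → j ≤ n1 → pos j ≡ j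
  pos-left j j≤n1 = cong (λ b → if b then j else suc n ∸ j) (≤ᵇ-true j n1 j≤n1)

  pos-right : ∀ j → n1 < j → pos j ≡ suc n ∸ j
  pos-right j n1<j = cong (λ b → if b then j else suc n ∸ j) (≤ᵇ-false j n1 n1<j)

  pos-range : ∀ j → 1 ≤ j → j ≤ n → 1 ≤ pos j × pos j ≤ n1
  pos-range j j1 jn with half j
  ... | left j≤n1 = subst (λ z → 1 ≤ z × z ≤ n1) (sym (pos-left j j≤n1)) (j1 , j≤n1)
  ... | right n1<j = subst (λ z → 1 ≤ z × z ≤ n1) (sym (trans (pos-right j n1<j) (proj₁ (mirror-of-right j n1<j jn))))
                           (s≤s z≤n , proj₂ (mirror-of-right j n1<j jn))

  next-row : ∀ {i} → i ≤ m ∸ 1 → suc i ≤ m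
  next-row i≤ = subst (_ ≤_) (suc-∸1 m≥1) (s≤s i≤)

  module FromPaths (P : ℕ → ℕ → ℕ)
    (paths : ∀ k → 1 ≤ k → k ≤ m → AdmissiblePath m n n1 a (P k))
    (disjoint : ∀ k k' j j' → 1 ≤ k → k ≤ m → 1 ≤ k' → k' ≤ m →
         1 ≤ j → j ≤ n1 → 1 ≤ j' → j' ≤ n1 → P k j ≡ P k' j' → k ≡ k')
    (cover : ∀ q → GVert m n q →
         Σ ℕ λ k → Σ ℕ λ j → (1 ≤ k × k ≤ m) × (1 ≤ j × j ≤ n1) × P k j ≡ q)
    where

    witness : ℕ → ℕ → ℕ
    witness k j with 1 ≤? k | k ≤? m
    ... | yes k1 | yes km = proj₁ (proj₂ (proj₂ (paths k k1 km))) j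
    ... | _ | _ = 0

    witness∈P : ∀ k j → 1 ≤ k → k ≤ m → 1 ≤ j → j ≤ n1 → InPair m n (P k j) (witness k j)
    witness∈P k j k1 km with 1 ≤? k | k ≤? m
    ... | yes k1' | yes km' = proj₁ (proj₂ (proj₂ (proj₂ (paths k k1' km')))) j
    ... | no ¬k1 | _ = ⊥-elim (¬k1 k1)
    ... | yes _ | no ¬km = ⊥-elim (¬km km)

    witness-sum : ∀ k j → 1 ≤ k → k ≤ m → 1 ≤ j → j ≤ n1 ∸ 1 → witness k j + witness k (suc j) ≡ a j
    witness-sum k j k1 km with 1 ≤? k | k ≤? m
    ... | yes k1' | yes km' = proj₂ (proj₂ (proj₂ (proj₂ (paths k k1' km')))) j
    ... | no ¬k1 | _ = ⊥-elim (¬k1 k1)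
    ... | yes _ | no ¬km = ⊥-elim (¬km km)

    P-GVert : ∀ k j → 1 ≤ k → k ≤ m → 1 ≤ j → j ≤ n1 → GVert m n (P k j)
    P-GVert k j k1 km = proj₁ (paths k k1 km) j

    P-injective : ∀ k j j' → 1 ≤ k → k ≤ m → 1 ≤ j → j ≤ n1 → 1 ≤ j' → j' ≤ n1 → P k j ≡ P k j' → j ≡ j'
    P-injective k j j' k1 km = proj₁ (proj₂ (paths k k1 km)) j j'

    witness≤N⁺ : ∀ k j → 1 ≤ k → k ≤ m → 1 ≤ j → j ≤ n1 → witness k j ≤ N⁺
    witness≤N⁺ k j k1 km j1 jn =
      ≤-trans (proj₂ (InPair-range (P-GVert k j k1 km j1 jn) (witness∈P k j k1 km j1 jn))) (n≤1+n N)

    -- Row i follows path σ i: left to right on the left half, back on the right half,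
    -- with the orientation alternating between rows and between halves.
    module RowAssignment (σ : ℕ → ℕ) (σ-perm : IsPermutation m σ) where

      open IsPermutation σ-perm

      y : ℕ → ℕ → ℕ
      y i j = witness (σ i) j

      orientation : ℕ → ℕ → Bool
      orientation i j = if j ≤ᵇ n1 then isOdd i else not (isOdd i)

      X : Labeling
      X i j = orient (orientation i j) (y i (pos j))

      X-left : ∀ i j → j ≤ n1 → X i j ≡ orient (isOdd i) (y i j)
      X-left i j j≤n1 rewrite ≤ᵇ-true j n1 j≤n1 = refl

      X-right : ∀ i j → n1 < j → X i j ≡ orient (not (isOdd i)) (y i (suc n ∸ j))
      X-right i j n1<j rewrite ≤ᵇ-false j n1 n1<j = refl

      y≤N⁺ : ∀ i j → 1 ≤ i → i ≤ m → 1 ≤ j → j ≤ n1 → y i j ≤ N⁺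
      y≤N⁺ i j i1 im = witness≤N⁺ (σ i) j (proj₁ (range i i1 im)) (proj₂ (range i i1 im))

      y-sum : ∀ i j → 1 ≤ i → i ≤ m → 1 ≤ j → j ≤ n1 ∸ 1 → y i j + y i (suc j) ≡ a j
      y-sum i j i1 im = witness-sum (σ i) j (proj₁ (range i i1 im)) (proj₂ (range i i1 im))

      cellVertex-GVert : ∀ i j → InV m n i j → GVert m n (P (σ i) (pos j))
      cellVertex-GVert i j ((i1 , im) , (j1 , jn)) =
        P-GVert (σ i) (pos j) (proj₁ (range i i1 im)) (proj₂ (range i i1 im))
          (proj₁ (pos-range j j1 jn)) (proj₂ (pos-range j j1 jn))

      X∈cellVertex : ∀ i j → InV m n i j → InPair m n (P (σ i) (pos j)) (X i j)
      X∈cellVertex i j v@((i1 , im) , (j1 , jn)) =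
        InPair-orient (orientation i j) (GVert⇒≤N⁺ (cellVertex-GVert i j v))
          (witness∈P (σ i) (pos j) (proj₁ (range i i1 im)) (proj₂ (range i i1 im))
            (proj₁ (pos-range j j1 jn)) (proj₂ (pos-range j j1 jn)))

      complementary-pairs : ∀ x₁ x₂ x₃ x₄ → x₁ + x₂ ≡ N⁺ → x₃ + x₄ ≡ N⁺ → x₁ + x₂ + x₃ + x₄ ≡ N⁺ + N⁺
      complementary-pairs x₁ x₂ x₃ x₄ e₁ e₂ = trans (+-assoc (x₁ + x₂) x₃ x₄) (cong₂ _+_ e₁ e₂)

      rows-agree : ∀ i i' j → 1 ≤ i → i ≤ m → 1 ≤ i' → i' ≤ m → 1 ≤ j → suc j ≤ n1 →
        y i j + y i (suc j) ≡ y i' j + y i' (suc j)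
      rows-agree i i' j i1 im i1' im' j1 sj≤ =
        trans (y-sum i j i1 im j1 (<⇒≤pred sj≤)) (sym (y-sum i' j i1' im' j1 (<⇒≤pred sj≤)))

      rows-agree-reversed : ∀ i i' j → 1 ≤ i → i ≤ m → 1 ≤ i' → i' ≤ m → 1 ≤ j → suc j ≤ n1 →
        y i (suc j) + y i j ≡ y i' (suc j) + y i' j
      rows-agree-reversed i i' j i1 im i1' im' j1 sj≤ =
        trans (+-comm (y i (suc j)) (y i j))
              (trans (rows-agree i i' j i1 im i1' im' j1 sj≤) (+-comm (y i' j) (y i' (suc j))))

      face-left : ∀ i j → 1 ≤ i → suc i ≤ m → 1 ≤ j → j < n1 →
        X i j + X i (cyc n (suc j)) + X (suc i) j + X (suc i) (cyc n (suc j)) ≡ N⁺ + N⁺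
      face-left i j i1 si≤m j1 j<n1
        rewrite cyc-id n (suc j) (s≤s z≤n) (≤-trans j<n1 n1≤n)
              | X-left i j (<⇒≤ j<n1) | X-left i (suc j) j<n1
              | X-left (suc i) j (<⇒≤ j<n1) | X-left (suc i) (suc j) j<n1
        = face-sum (isOdd i) _ _ _ _
            (y≤N⁺ i j i1 im j1 (<⇒≤ j<n1)) (y≤N⁺ i (suc j) i1 im (s≤s z≤n) j<n1)
            (y≤N⁺ (suc i) j (s≤s z≤n) si≤m j1 (<⇒≤ j<n1)) (y≤N⁺ (suc i) (suc j) (s≤s z≤n) si≤m (s≤s z≤n) j<n1)
            (rows-agree i (suc i) j i1 im (s≤s z≤n) si≤m j1 j<n1)
        where
        im = ≤-trans (n≤1+n i) si≤m

      face-middle : ∀ i → 1 ≤ i → suc i ≤ m →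
        X i n1 + X i (cyc n (suc n1)) + X (suc i) n1 + X (suc i) (cyc n (suc n1)) ≡ N⁺ + N⁺
      face-middle i i1 si≤m
        rewrite cyc-id n (suc n1) (s≤s z≤n) n1<n
              | X-left i n1 ≤-refl | X-right i (suc n1) (n<1+n n1)
              | X-left (suc i) n1 ≤-refl | X-right (suc i) (suc n1) (n<1+n n1)
              | n∸n1≡n1
        = complementary-pairs
            (orient (isOdd i) (y i n1)) (orient (not (isOdd i)) (y i n1))
            (orient (isOdd (suc i)) (y (suc i) n1)) (orient (not (isOdd (suc i))) (y (suc i) n1))
            (orient-sum (isOdd i) (y i n1) (y≤N⁺ i n1 i1 (≤-trans (n≤1+n i) si≤m) n1≥1 ≤-refl))
            (orient-sum (isOdd (suc i)) (y (suc i) n1) (y≤N⁺ (suc i) n1 (s≤s z≤n) si≤m n1≥1 ≤-refl))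

      face-right : ∀ i j → 1 ≤ i → suc i ≤ m → n1 < j → j < n →
        X i j + X i (cyc n (suc j)) + X (suc i) j + X (suc i) (cyc n (suc j)) ≡ N⁺ + N⁺
      face-right i j i1 si≤m n1<j j<n
        rewrite cyc-id n (suc j) (s≤s z≤n) j<n
              | X-right i j n1<j | X-right i (suc j) (<-trans n1<j (n<1+n j))
              | X-right (suc i) j n1<j | X-right (suc i) (suc j) (<-trans n1<j (n<1+n j))
              | proj₁ (mirror-of-right j n1<j (<⇒≤ j<n))
        = face-sum (not (isOdd i)) _ _ _ _
            (y≤N⁺ i (suc p) i1 im (s≤s z≤n) sp≤n1) (y≤N⁺ i p i1 im p1 (<⇒≤ sp≤n1))
            (y≤N⁺ (suc i) (suc p) (s≤s z≤n) si≤m (s≤s z≤n) sp≤n1) (y≤N⁺ (suc i) p (s≤s z≤n) si≤m p1 (<⇒≤ sp≤n1))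
            (rows-agree-reversed i (suc i) p i1 im (s≤s z≤n) si≤m p1 sp≤n1)
        where
        p = n ∸ j
        sp≤n1 = proj₂ (mirror-of-right j n1<j (<⇒≤ j<n))
        p1 = m<n⇒0<n∸m j<n
        im = ≤-trans (n≤1+n i) si≤m

      face-wrap : ∀ i → 1 ≤ i → suc i ≤ m →
        X i n + X i (cyc n (suc n)) + X (suc i) n + X (suc i) (cyc n (suc n)) ≡ N⁺ + N⁺
      face-wrap i i1 si≤m
        rewrite cyc-1+n n n≥1
              | X-right i n n1<n | X-left i 1 n1≥1
              | X-right (suc i) n n1<n | X-left (suc i) 1 n1≥1
              | m+n∸n≡m 1 n
        = complementary-pairs
            (orient (not (isOdd i)) (y i 1)) (orient (isOdd i) (y i 1))
            (orient (not (isOdd (suc i))) (y (suc i) 1)) (orient (isOdd (suc i)) (y (suc i) 1))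
            (orient-sum' (isOdd i) (y i 1) (y≤N⁺ i 1 i1 (≤-trans (n≤1+n i) si≤m) ≤-refl n1≥1))
            (orient-sum' (isOdd (suc i)) (y (suc i) 1) (y≤N⁺ (suc i) 1 (s≤s z≤n) si≤m ≤-refl n1≥1))

      face : ∀ i j → 1 ≤ i → i ≤ m ∸ 1 → 1 ≤ j → j ≤ n →
        X i j + X i (cyc n (suc j)) + X (suc i) j + X (suc i) (cyc n (suc j)) ≡ N⁺ + N⁺
      face i j i1 i≤ j1 jn with <-cmp j n1
      ... | tri< j<n1 _ _ = face-left i j i1 (next-row i≤) j1 j<n1
      ... | tri≈ _ refl _ = face-middle i i1 (next-row i≤)
      ... | tri> _ _ n1<j with j <? n
      ...   | yes j<n = face-right i j i1 (next-row i≤) n1<j j<n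
      ...   | no j≮n with ≤-antisym jn (≮⇒≥ j≮n)
      ...     | refl = face-wrap i i1 (next-row i≤)

      y-row-m≤N⁺ : ∀ j → 1 ≤ j → j ≤ n1 → y m j ≤ N⁺
      y-row-m≤N⁺ j = y≤N⁺ m j m≥1 ≤-refl

      y-row-1≤N⁺ : ∀ j → 1 ≤ j → j ≤ n1 → y 1 j ≤ N⁺
      y-row-1≤N⁺ j = y≤N⁺ 1 j ≤-refl m≥1

      twist-left : ∀ j → 1 ≤ j → j < n1 →
        X m j + X m (cyc n (suc j)) + X 1 (cyc n (suc n ∸ j)) + X 1 (cyc n (n ∸ j)) ≡ N⁺ + N⁺
      twist-left j j1 j<n1
        rewrite cyc-id n (suc j) (s≤s z≤n) (≤-trans j<n1 n1≤n)
              | cyc-id n (suc n ∸ j) (≤-trans (s≤s z≤n) (mirror-right j (<⇒≤ j<n1))) (mirror≤n j j1)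
              | cyc-id n (n ∸ j) (m<n⇒0<n∸m (<-trans j<n1 n1<n)) (m∸n≤m n j)
              | X-left m j (<⇒≤ j<n1) | X-left m (suc j) j<n1
              | X-right 1 (suc n ∸ j) (mirror-right j (<⇒≤ j<n1))
              | X-right 1 (n ∸ j) (subst (_< n ∸ j) n∸n1≡n1 (∸-monoʳ-< j<n1 n1≤n))
              | mirror-involutive j (≤-trans (<⇒≤ j<n1) n1≤n)
              | +-∸-assoc 1 (m∸n≤m n j) | m∸[m∸n]≡n (≤-trans (<⇒≤ j<n1) n1≤n)
              | isOdd-m
        = face-sum true _ _ _ _
            (y-row-m≤N⁺ j j1 (<⇒≤ j<n1)) (y-row-m≤N⁺ (suc j) (s≤s z≤n) j<n1)
            (y-row-1≤N⁺ j j1 (<⇒≤ j<n1)) (y-row-1≤N⁺ (suc j) (s≤s z≤n) j<n1)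
            (rows-agree m 1 j m≥1 ≤-refl ≤-refl m≥1 j1 j<n1)

      twist-middle :
        X m n1 + X m (cyc n (suc n1)) + X 1 (cyc n (suc n ∸ n1)) + X 1 (cyc n (n ∸ n1)) ≡ N⁺ + N⁺
      twist-middle =
        trans (cong₂ _+_ (cong₂ _+_ (cong₂ _+_ cell₁ cell₂) cell₃) cell₄)
          (complementary-pairs (y m n1) (compl (y m n1)) (compl (y 1 n1)) (y 1 n1)
            (orient-sum true (y m n1) (y-row-m≤N⁺ n1 n1≥1 ≤-refl))
            (orient-sum' true (y 1 n1) (y-row-1≤N⁺ n1 n1≥1 ≤-refl)))
        where
        next-column : cyc n (suc n ∸ n1) ≡ suc n1
        next-column = trans (cong (cyc n) (trans (+-∸-assoc 1 n1≤n) (cong suc n∸n1≡n1))) (cyc-id n (suc n1) (s≤s z≤n) n1<n)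
        cell₁ : X m n1 ≡ y m n1
        cell₁ = trans (X-left m n1 ≤-refl) (cong (λ b → orient b (y m n1)) isOdd-m)
        cell₂ : X m (cyc n (suc n1)) ≡ compl (y m n1)
        cell₂ = trans (cong (X m) (cyc-id n (suc n1) (s≤s z≤n) n1<n))
                  (trans (X-right m (suc n1) (n<1+n n1)) (cong₂ (λ b c → orient (not b) (y m c)) isOdd-m n∸n1≡n1))
        cell₃ : X 1 (cyc n (suc n ∸ n1)) ≡ compl (y 1 n1)
        cell₃ = trans (cong (X 1) next-column) (trans (X-right 1 (suc n1) (n<1+n n1)) (cong (λ c → compl (y 1 c)) n∸n1≡n1))
        cell₄ : X 1 (cyc n (n ∸ n1)) ≡ y 1 n1
        cell₄ = trans (cong (X 1) (trans (cong (cyc n) n∸n1≡n1) (cyc-id n n1 n1≥1 n1≤n))) (X-left 1 n1 ≤-refl)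

      twist-right : ∀ j → n1 < j → j < n →
        X m j + X m (cyc n (suc j)) + X 1 (cyc n (suc n ∸ j)) + X 1 (cyc n (n ∸ j)) ≡ N⁺ + N⁺
      twist-right j n1<j j<n
        rewrite cyc-id n (suc j) (s≤s z≤n) j<n
              | X-right m j n1<j | X-right m (suc j) (<-trans n1<j (n<1+n j))
              | proj₁ (mirror-of-right j n1<j (<⇒≤ j<n))
              | cyc-id n (suc (n ∸ j)) (s≤s z≤n) (≤-trans (proj₂ (mirror-of-right j n1<j (<⇒≤ j<n))) n1≤n)
              | cyc-id n (n ∸ j) (m<n⇒0<n∸m j<n) (m∸n≤m n j)
              | X-left 1 (suc (n ∸ j)) (proj₂ (mirror-of-right j n1<j (<⇒≤ j<n)))
              | X-left 1 (n ∸ j) (<⇒≤ (proj₂ (mirror-of-right j n1<j (<⇒≤ j<n))))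
              | isOdd-m
        = face-sum false _ _ _ _
            (y-row-m≤N⁺ (suc p) (s≤s z≤n) sp≤n1) (y-row-m≤N⁺ p p1 (<⇒≤ sp≤n1))
            (y-row-1≤N⁺ (suc p) (s≤s z≤n) sp≤n1) (y-row-1≤N⁺ p p1 (<⇒≤ sp≤n1))
            (rows-agree-reversed m 1 p m≥1 ≤-refl ≤-refl m≥1 p1 sp≤n1)
        where
        p = n ∸ j
        sp≤n1 = proj₂ (mirror-of-right j n1<j (<⇒≤ j<n))
        p1 = m<n⇒0<n∸m j<n

      twist-wrap :
        X m n + X m (cyc n (suc n)) + X 1 (cyc n (suc n ∸ n)) + X 1 (cyc n (n ∸ n)) ≡ N⁺ + N⁺
      twist-wrap =
        trans (cong₂ _+_ (cong₂ _+_ (cong₂ _+_ cell₁ cell₂) cell₃) cell₄)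
          (complementary-pairs (compl (y m 1)) (y m 1) (y 1 1) (compl (y 1 1))
            (orient-sum' true (y m 1) (y-row-m≤N⁺ 1 ≤-refl n1≥1))
            (orient-sum true (y 1 1) (y-row-1≤N⁺ 1 ≤-refl n1≥1)))
        where
        cell₁ : X m n ≡ compl (y m 1)
        cell₁ = trans (X-right m n n1<n) (cong₂ (λ b c → orient (not b) (y m c)) isOdd-m (m+n∸n≡m 1 n))
        cell₂ : X m (cyc n (suc n)) ≡ y m 1
        cell₂ = trans (cong (X m) (cyc-1+n n n≥1)) (trans (X-left m 1 n1≥1) (cong (λ b → orient b (y m 1)) isOdd-m))
        cell₃ : X 1 (cyc n (suc n ∸ n)) ≡ y 1 1
        cell₃ = trans (cong (X 1) (trans (cong (cyc n) (m+n∸n≡m 1 n)) (cyc-id n 1 ≤-refl n≥1))) (X-left 1 1 n1≥1)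
        cell₄ : X 1 (cyc n (n ∸ n)) ≡ compl (y 1 1)
        cell₄ = trans (cong (X 1) (trans (cong (cyc n) (n∸n≡0 n)) (cyc-0 n n≥1)))
                  (trans (X-right 1 n n1<n) (cong (λ c → compl (y 1 c)) (m+n∸n≡m 1 n)))

      twist : ∀ j → 1 ≤ j → j ≤ n →
        X m j + X m (cyc n (suc j)) + X 1 (cyc n (suc n ∸ j)) + X 1 (cyc n (n ∸ j)) ≡ N⁺ + N⁺
      twist j j1 jn with <-cmp j n1
      ... | tri< j<n1 _ _ = twist-left j j1 j<n1
      ... | tri≈ _ refl _ = twist-middle
      ... | tri> _ _ n1<j with j <? n
      ...   | yes j<n = twist-right j n1<j j<n
      ...   | no j≮n with ≤-antisym jn (≮⇒≥ j≮n)
      ...     | refl = twist-wrap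

      faceMagic : C4FaceMagic m n X
      faceMagic = N⁺ + N⁺ , face , twist

      X-range : ∀ i j → InV m n i j → 1 ≤ X i j × X i j ≤ m * n
      X-range i j v = InPair-range (cellVertex-GVert i j v) (X∈cellVertex i j v)

      X-injective : ∀ i j i' j' → InV m n i j → InV m n i' j' → X i j ≡ X i' j' → i ≡ i' × j ≡ j'
      X-injective i j i' j' v@((i1 , im) , (j1 , jn)) v'@((i1' , im') , (j1' , jn')) X≡ = i≡i' , j≡j'
        where
        same-vertex : P (σ i) (pos j) ≡ P (σ i') (pos j')
        same-vertex = InPair-unique (cellVertex-GVert i j v) (cellVertex-GVert i' j' v')
                        (X∈cellVertex i j v) (subst (InPair m n _) (sym X≡) (X∈cellVertex i' j' v'))
        i≡i' : i ≡ i'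
        i≡i' = injective i i' i1 im i1' im' (disjoint (σ i) (σ i') (pos j) (pos j')
                 (proj₁ (range i i1 im)) (proj₂ (range i i1 im)) (proj₁ (range i' i1' im')) (proj₂ (range i' i1' im'))
                 (proj₁ (pos-range j j1 jn)) (proj₂ (pos-range j j1 jn))
                 (proj₁ (pos-range j' j1' jn')) (proj₂ (pos-range j' j1' jn')) same-vertex)
        pos≡ : pos j ≡ pos j'
        pos≡ = P-injective (σ i) (pos j) (pos j') (proj₁ (range i i1 im)) (proj₂ (range i i1 im))
                 (proj₁ (pos-range j j1 jn)) (proj₂ (pos-range j j1 jn))
                 (proj₁ (pos-range j' j1' jn')) (proj₂ (pos-range j' j1' jn'))
                 (trans same-vertex (cong (λ z → P (σ z) (pos j')) (sym i≡i')))
        same-row : X i j ≡ X i j'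
        same-row = trans X≡ (cong (λ z → X z j') (sym i≡i'))
        opposite-halves : ∀ l r → l ≤ n1 → n1 < r → pos l ≡ pos r → X i l ≢ X i r
        opposite-halves l r l≤n1 n1<r pos≡' e = orient-≢ (isOdd i) (y i l)
          (trans (sym (X-left i l l≤n1)) (trans e (trans (X-right i r n1<r)
            (cong (λ c → orient (not (isOdd i)) (y i c)) (trans (sym (pos-right r n1<r)) (trans (sym pos≡') (pos-left l l≤n1)))))))
        j≡j' : j ≡ j'
        j≡j' with half j | half j'
        ... | left l | left l' = trans (sym (pos-left j l)) (trans pos≡ (pos-left j' l'))
        ... | right r | right r' = ∸-cancelˡ-≡ (≤-trans jn (n≤1+n n)) (≤-trans jn' (n≤1+n n))
                                     (trans (sym (pos-right j r)) (trans pos≡ (pos-right j' r')))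
        ... | left l | right r' = ⊥-elim (opposite-halves j j' l r' pos≡ same-row)
        ... | right r | left l' = ⊥-elim (opposite-halves j' j l' r (sym pos≡) (sym same-row))

      X-surjective : ∀ q → 1 ≤ q → q ≤ m * n → Σ ℕ λ i → Σ ℕ λ j → InV m n i j × X i j ≡ q
      X-surjective q q1 q≤N with label-vertex q q1 q≤N
      ... | p , gp , q∈p with cover p gp
      ...   | k , j , (k1 , km) , (j1 , jn) , Pkj≡p with surjective k k1 km
      ...     | r , (r1 , rm) , σr≡k =
        choose (isOdd r) (X-left r j jn) X-mirror (InPair-same (GVert⇒≤N⁺ gp) q∈p W∈p)
        where
        W = y r j
        W∈p : InPair m n p W
        W∈p = subst (λ p' → InPair m n p' W) (trans (cong (λ z → P z j) σr≡k) Pkj≡p)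
                (witness∈P (σ r) j (proj₁ (range r r1 rm)) (proj₂ (range r r1 rm)) j1 jn)
        X-mirror : X r (suc n ∸ j) ≡ orient (not (isOdd r)) W
        X-mirror = trans (X-right r (suc n ∸ j) (mirror-right j jn))
                     (cong (λ c → orient (not (isOdd r)) (y r c)) (mirror-involutive j (≤-trans jn n1≤n)))
        cell : InV m n r j
        cell = (r1 , rm) , (j1 , ≤-trans jn n1≤n)
        mirror-cell : InV m n r (suc n ∸ j)
        mirror-cell = (r1 , rm) , (≤-trans (s≤s z≤n) (mirror-right j jn) , mirror≤n j j1)
        choose : ∀ b → X r j ≡ orient b W → X r (suc n ∸ j) ≡ orient (not b) W → q ≡ W ⊎ q ≡ compl W →
                 Σ ℕ λ i → Σ ℕ λ j' → InV m n i j' × X i j' ≡ q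
        choose true e _ (inj₁ q≡) = r , j , cell , trans e (sym q≡)
        choose true _ e (inj₂ q≡) = r , suc n ∸ j , mirror-cell , trans e (sym q≡)
        choose false _ e (inj₁ q≡) = r , suc n ∸ j , mirror-cell , trans e (sym q≡)
        choose false e _ (inj₂ q≡) = r , j , cell , trans e (sym q≡)

      magicLabeling : C4FaceMagicKBLabeling m n X
      magicLabeling = (X-range , X-injective , X-surjective) , faceMagic

      rep-X : ∀ i j → InV m n i j → rep m n (X i j) ≡ P (σ i) (pos j)
      rep-X i j v = rep-InPair (cellVertex-GVert i j v) (X∈cellVertex i j v)

      row-edge-left : ∀ r j → 1 ≤ r → r ≤ m → 1 ≤ j → j ≤ n1 ∸ 1 →
        rep m n (X r j) ≡ P (σ r) j × rep m n (X r (suc j)) ≡ P (σ r) (suc j)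
      row-edge-left r j r1 rm j1 j≤ =
        trans (rep-X r j ((r1 , rm) , (j1 , ≤-trans j≤n1 n1≤n))) (cong (P (σ r)) (pos-left j j≤n1)) ,
        trans (rep-X r (suc j) ((r1 , rm) , (s≤s z≤n , ≤-trans (suc≤n1 j≤) n1≤n))) (cong (P (σ r)) (pos-left (suc j) (suc≤n1 j≤)))
        where
        j≤n1 = ≤-trans (n≤1+n j) (suc≤n1 j≤)

      row-edge-right : ∀ r j → 1 ≤ r → r ≤ m → 1 ≤ j → j ≤ n1 ∸ 1 →
        rep m n (X r (suc n ∸ j)) ≡ P (σ r) j × rep m n (X r (n ∸ j)) ≡ P (σ r) (suc j)
      row-edge-right r j r1 rm j1 j≤ =
        trans (rep-X r (suc n ∸ j) ((r1 , rm) , (≤-trans (s≤s z≤n) (mirror-right j j≤n1)) , mirror≤n j j1))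
              (cong (P (σ r)) (trans (pos-right (suc n ∸ j) (mirror-right j j≤n1)) (mirror-involutive j (≤-trans j≤n1 n1≤n)))) ,
        trans (rep-X r (n ∸ j) ((r1 , rm) , (≤-trans (s≤s z≤n) n1<n∸j , m∸n≤m n j)))
              (cong (P (σ r)) (trans (pos-right (n ∸ j) n1<n∸j)
                (trans (+-∸-assoc 1 (m∸n≤m n j)) (cong suc (m∸[m∸n]≡n (≤-trans j≤n1 n1≤n))))))
        where
        j≤n1 = ≤-trans (n≤1+n j) (suc≤n1 j≤)
        n1<n∸j : n1 < n ∸ j
        n1<n∸j = subst (_< n ∸ j) n∸n1≡n1 (∸-monoʳ-< (suc≤n1 j≤) n1≤n)

      LGraph⇒PathEdges : ∀ p q → LGraph m n X p q → PathEdges m n1 P p q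
      LGraph⇒PathEdges p q (inj₁ (i , j , (i1 , i≤) , j-bounds@(j1 , j≤) , e)) =
        σ r , j , range r r1 rm , j-bounds ,
          UEdge-cong (proj₁ (row-edge-left r j r1 rm j1 j≤)) (proj₂ (row-edge-left r j r1 rm j1 j≤)) e
        where
        r = 2 * i ∸ 1
        r1 = proj₁ (2*i∸1-bounds i m i1 i≤)
        rm = proj₂ (2*i∸1-bounds i m i1 i≤)
      LGraph⇒PathEdges p q (inj₂ (i , j , (i1 , i≤) , j-bounds@(j1 , j≤) , e)) =
        σ r , j , range r r1 rm , j-bounds ,
          UEdge-cong (proj₁ (row-edge-right r j r1 rm j1 j≤)) (proj₂ (row-edge-right r j r1 rm j1 j≤)) e
        where
        r = 2 * i
        r1 = proj₁ (2*i-bounds i (m ∸ 1) i1 i≤)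
        rm = ≤-trans (proj₂ (2*i-bounds i (m ∸ 1) i1 i≤)) (m∸n≤m m 1)

      PathEdges⇒LGraph : ∀ p q → PathEdges m n1 P p q → LGraph m n X p q
      PathEdges⇒LGraph p q (k , j , (k1 , km) , j-bounds@(j1 , j≤) , e) with surjective k k1 km
      ... | r , (r1 , rm) , σr≡k with parityView r
      ...   | odd t r≡ = inj₁ (suc t , j , (s≤s z≤n , t-bound) , j-bounds ,
                UEdge-cong (sym (trans (cong (λ z → rep m n (X z j)) row≡)
                                       (trans (proj₁ (row-edge-left r j r1 rm j1 j≤)) (cong (λ z → P z j) σr≡k))))
                           (sym (trans (cong (λ z → rep m n (X z (suc j))) row≡)
                                       (trans (proj₂ (row-edge-left r j r1 rm j1 j≤)) (cong (λ z → P z (suc j)) σr≡k)))) e)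
        where
        row≡ : 2 * suc t ∸ 1 ≡ r
        row≡ = trans (2*[1+t]∸1≡1+t+t t) (sym r≡)
        t-bound : suc t ≤ ⌊ suc m /2⌋
        t-bound = double≤⇒≤⌊/2⌋ (suc t) (suc m)
                    (subst (_≤ suc m) (sym (cong suc (+-suc t t))) (s≤s (subst (_≤ m) r≡ rm)))
      ...   | even t r≡ = inj₂ (t , j , (t1 , t-bound) , j-bounds ,
                UEdge-cong (sym (trans (cong (λ z → rep m n (X z (suc n ∸ j))) row≡)
                                       (trans (proj₁ (row-edge-right r j r1 rm j1 j≤)) (cong (λ z → P z j) σr≡k))))
                           (sym (trans (cong (λ z → rep m n (X z (n ∸ j))) row≡)
                                       (trans (proj₂ (row-edge-right r j r1 rm j1 j≤)) (cong (λ z → P z (suc j)) σr≡k)))) e)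
        where
        row≡ : 2 * t ≡ r
        row≡ = trans (2*n≡n+n t) (sym r≡)
        t1 : 1 ≤ t
        t1 with t ≟ 0
        ... | yes refl = ⊥-elim (<⇒≢ r1 (sym r≡))
        ... | no t≢0 = n≢0⇒n>0 t≢0
        t-bound : t ≤ ⌊ m ∸ 1 /2⌋
        t-bound = double≤⇒≤⌊/2⌋ t (m ∸ 1)
                    (<⇒≤pred (≤∧≢⇒< (subst (_≤ m) r≡ rm) (λ e' → n+n≢1+m+m t mh (trans e' m≡1+mh+mh))))

      LGraph≈PathEdges : SameGraph m n (LGraph m n X) (PathEdges m n1 P)
      LGraph≈PathEdges p q _ _ = LGraph⇒PathEdges p q , PathEdges⇒LGraph p q

    -- A Klein bottle symmetry maps row i onto row (rowAction w i), so an equivalence X' = X ∘ w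
    -- forces σ' i = σ (rowAction w i); since both fix m, rowAction w fixes m and is the identity.
    equivalent⇒same-permutation : ∀ σ σ' (σ-perm : IsPermutation m σ) (σ'-perm : IsPermutation m σ') →
      σ m ≡ m → σ' m ≡ m →
      KBEquivalent m n (RowAssignment.X σ σ-perm) (RowAssignment.X σ' σ'-perm) →
      ∀ x → 1 ≤ x → x ≤ m → σ' x ≡ σ x
    equivalent⇒same-permutation σ σ' σ-perm σ'-perm σm≡m σ'm≡m (w , X'≡) x x1 xm =
      trans (row-image x x1 xm) (cong σ (rowAction-fixing-m w w-fixes-m x (x1 , xm)))
      where
      module A = RowAssignment σ σ-perm
      module B = RowAssignment σ' σ'-perm
      open IsPermutation
      row-image : ∀ i → 1 ≤ i → i ≤ m → σ' i ≡ σ (rowAction w i)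
      row-image i i1 im =
        trans (disjoint (σ' i) (σ r) (pos 1) (pos c)
                 (proj₁ (range σ'-perm i i1 im)) (proj₂ (range σ'-perm i i1 im))
                 (proj₁ (range σ-perm r (proj₁ r-range) (proj₂ r-range))) (proj₂ (range σ-perm r (proj₁ r-range) (proj₂ r-range)))
                 (proj₁ (pos-range 1 ≤-refl n≥1)) (proj₂ (pos-range 1 ≤-refl n≥1))
                 (proj₁ (pos-range c (proj₁ c-range) (proj₂ c-range))) (proj₂ (pos-range c (proj₁ c-range) (proj₂ c-range)))
                 same-vertex)
              (cong σ (act-row w i 1))
        where
        r = proj₁ (act m n w (i , 1))
        c = proj₂ (act m n w (i , 1))
        c-range = act-col-range w i 1 ≤-refl n≥1
        r-range : InRows r
        r-range = subst InRows (sym (act-row w i 1)) (rowAction-range w i (i1 , im))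
        cell : InV m n i 1
        cell = (i1 , im) , (≤-refl , n≥1)
        same-vertex : P (σ' i) (pos 1) ≡ P (σ r) (pos c)
        same-vertex = InPair-unique (B.cellVertex-GVert i 1 cell) (A.cellVertex-GVert r c (r-range , c-range))
                        (B.X∈cellVertex i 1 cell) (subst (InPair m n _) (sym (X'≡ i 1 cell)) (A.X∈cellVertex r c (r-range , c-range)))
      w-fixes-m : rowAction w m ≡ m
      w-fixes-m = injective σ-perm (rowAction w m) m
                    (proj₁ (rowAction-range w m (m≥1 , ≤-refl))) (proj₂ (rowAction-range w m (m≥1 , ≤-refl))) m≥1 ≤-refl
                    (trans (sym (row-image m m≥1 ≤-refl)) (trans σ'm≡m (sym σm≡m)))

  labelings : ∀ K → AdmPathPartition m n a K →
    Σ (Fin ((m ∸ 1) !) → Labeling) λ Xs →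
      (∀ t → C4FaceMagicKBLabeling m n (Xs t) × SameGraph m n (LGraph m n (Xs t)) K)
      × (∀ t t' → t ≢ t' → ¬ KBEquivalent m n (Xs t) (Xs t'))
  labelings K (P , paths , disjoint , cover , _ , K≈PathEdges) = Xs , good , nonequivalent
    where
    open FromPaths P paths disjoint cover
    σ : ℕ → ℕ → ℕ
    σ T = decodePerm (m ∸ 1) T
    σ-perm : ∀ T → IsPermutation m (σ T)
    σ-perm T = decodePerm-isPermutation m (m ∸ 1) T (m∸n≤m m 1)
    σ-fixes-m : ∀ T → σ T m ≡ m
    σ-fixes-m T = decodePerm-fixes (m ∸ 1) T m (subst (m ∸ 1 <_) (suc-∸1 m≥1) ≤-refl)
    Xs : Fin ((m ∸ 1) !) → Labeling
    Xs t = RowAssignment.X (σ (toℕ t)) (σ-perm (toℕ t))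
    good : ∀ t → C4FaceMagicKBLabeling m n (Xs t) × SameGraph m n (LGraph m n (Xs t)) K
    good t = magicLabeling , SameGraph-trans {m} {n} LGraph≈PathEdges (SameGraph-sym {m} {n} K≈PathEdges)
      where
      open RowAssignment (σ (toℕ t)) (σ-perm (toℕ t))
    nonequivalent : ∀ t t' → t ≢ t' → ¬ KBEquivalent m n (Xs t) (Xs t')
    nonequivalent t t' t≢t' X≈X' = t≢t' (toℕ-injective
      (decodePerm-determines-code (m ∸ 1) (toℕ t) (toℕ t') (toℕ<n t) (toℕ<n t') same-on-lower))
      where
      same-on-lower : ∀ x → 1 ≤ x → x ≤ m ∸ 1 → σ (toℕ t) x ≡ σ (toℕ t') x
      same-on-lower x x1 x≤ = sym (equivalent⇒same-permutation (σ (toℕ t)) (σ (toℕ t')) (σ-perm _) (σ-perm _)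
                                     (σ-fixes-m _) (σ-fixes-m _) X≈X' x x1 (≤-trans x≤ (m∸n≤m m 1)))

DistinctPartitions : ℕ → ℕ → (ℕ → ℕ) → Set₁
DistinctPartitions m n a = Σ (Fin (2 ^ m) → Graph) λ Ks →
  (∀ t → AdmPathPartition m n a (Ks t)) × (∀ t t' → t ≢ t' → ¬ SameGraph m n (Ks t) (Ks t'))

module Flips (m n : ℕ) (m≥3 : 3 ≤ m) (m-odd : m % 2 ≡ 1) (n≥6 : 6 ≤ n) (n-even : n % 2 ≡ 0)
  (a : ℕ → ℕ) (d : ℕ) (P Z : ℕ → ℕ → ℕ) where

  open LabelPairs m n m≥3 m-odd n≥6 n-even

  instance
    n1-nonZero : NonZero n1
    n1-nonZero = >-nonZero n1≥1

  swapPos : ℕ → ℕ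
  swapPos j = if isOdd j then (if j ≡ᵇ n1 then j else suc j) else j ∸ 1

  swapFixed : ℕ → Bool
  swapFixed j = isOdd j ∧ (j ≡ᵇ n1)

  data SwapView (j : ℕ) : Set where
    odd-moves : isOdd j ≡ true → j ≢ n1 → swapPos j ≡ suc j → swapFixed j ≡ false → SwapView j
    odd-fixed : isOdd j ≡ true → j ≡ n1 → swapPos j ≡ j → swapFixed j ≡ true → SwapView j
    even-moves : isOdd j ≡ false → swapPos j ≡ j ∸ 1 → swapFixed j ≡ false → SwapView j

  ≡ᵇ-true : ∀ j k → j ≡ k → (j ≡ᵇ k) ≡ true
  ≡ᵇ-true j k j≡k with j ≡ᵇ k in eq
  ... | true = refl
  ... | false = ⊥-elim (subst T eq (≡⇒≡ᵇ j k j≡k))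

  ≡ᵇ-false : ∀ j k → j ≢ k → (j ≡ᵇ k) ≡ false
  ≡ᵇ-false j k j≢k with j ≡ᵇ k in eq
  ... | false = refl
  ... | true = ⊥-elim (j≢k (≡ᵇ⇒≡ j k (subst T (sym eq) tt)))

  swapPos-odd : ∀ j → isOdd j ≡ true → swapPos j ≡ (if j ≡ᵇ n1 then j else suc j)
  swapPos-odd j e = cong (λ b → if b then (if j ≡ᵇ n1 then j else suc j) else j ∸ 1) e

  swapView : ∀ j → SwapView j
  swapView j with isOdd j in odd? | j ≟ n1
  ... | true | yes j≡n1 =
    odd-fixed odd? j≡n1 (trans (swapPos-odd j odd?) (cong (λ b → if b then j else suc j) (≡ᵇ-true j n1 j≡n1)))
                        (trans (cong (_∧ (j ≡ᵇ n1)) odd?) (≡ᵇ-true j n1 j≡n1))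
  ... | true | no j≢n1 =
    odd-moves odd? j≢n1 (trans (swapPos-odd j odd?) (cong (λ b → if b then j else suc j) (≡ᵇ-false j n1 j≢n1)))
                        (trans (cong (_∧ (j ≡ᵇ n1)) odd?) (≡ᵇ-false j n1 j≢n1))
  ... | false | _ =
    even-moves odd? (cong (λ b → if b then (if j ≡ᵇ n1 then j else suc j) else j ∸ 1) odd?) (cong (_∧ (j ≡ᵇ n1)) odd?)

  true≢false : true ≢ false
  true≢false ()

  isOdd-suc-of-odd : ∀ j → isOdd j ≡ true → isOdd (suc j) ≡ false
  isOdd-suc-of-odd j odd? rewrite odd? = refl

  isOdd-of-even-suc : ∀ j → isOdd (suc j) ≡ false → isOdd j ≡ true
  isOdd-of-even-suc j e with isOdd j
  ... | true = refl
  ... | false = ⊥-elim (true≢false e)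

  even≥2 : ∀ j → 1 ≤ j → isOdd j ≡ false → 2 ≤ j
  even≥2 (suc zero) _ ()
  even≥2 (suc (suc j)) _ _ = s≤s (s≤s z≤n)

  swapPos-range : ∀ j → 1 ≤ j → j ≤ n1 → 1 ≤ swapPos j × swapPos j ≤ n1
  swapPos-range j j1 jn with swapView j
  ... | odd-moves _ j≢n1 e _ = subst (λ z → 1 ≤ z × z ≤ n1) (sym e) (s≤s z≤n , ≤∧≢⇒< jn j≢n1)
  ... | odd-fixed _ _ e _ = subst (λ z → 1 ≤ z × z ≤ n1) (sym e) (j1 , jn)
  ... | even-moves even? e _ =
    subst (λ z → 1 ≤ z × z ≤ n1) (sym e) (≤-pred (subst (2 ≤_) (sym (suc-∸1 j1)) (even≥2 j j1 even?)) , ≤-trans (m∸n≤m j 1) jn)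

  swapPos-involutive : ∀ j → 1 ≤ j → j ≤ n1 → swapPos (swapPos j) ≡ j
  swapPos-involutive j j1 jn with swapView j
  ... | odd-moves odd? _ e _ rewrite e with swapView (suc j)
  ...   | odd-moves odd?' _ _ _ = ⊥-elim (true≢false (trans (sym odd?') (isOdd-suc-of-odd j odd?)))
  ...   | odd-fixed odd?' _ _ _ = ⊥-elim (true≢false (trans (sym odd?') (isOdd-suc-of-odd j odd?)))
  ...   | even-moves _ e' _ = e'
  swapPos-involutive j j1 jn | odd-fixed _ _ e _ rewrite e = e
  swapPos-involutive (suc j₀) j1 jn | even-moves even? e _ rewrite e with swapView j₀
  ... | odd-moves _ _ e' _ = e'
  ... | odd-fixed _ j₀≡n1 _ _ = ⊥-elim (<⇒≢ jn j₀≡n1)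
  ... | even-moves even?' _ _ = ⊥-elim (true≢false (trans (sym (isOdd-of-even-suc j₀ even?)) even?'))

  swapPos-2 : swapPos 2 ≡ 1
  swapPos-2 = refl

  module Flipping
    (Z∈P : ∀ k j → 1 ≤ k → k ≤ m → 1 ≤ j → j ≤ n1 → InPair m n (P k j) (Z k j))
    (P-GVert : ∀ k j → 1 ≤ k → k ≤ m → 1 ≤ j → j ≤ n1 → GVert m n (P k j))
    (P-injective : ∀ k j k' j' → 1 ≤ k → k ≤ m → 1 ≤ j → j ≤ n1 → 1 ≤ k' → k' ≤ m → 1 ≤ j' → j' ≤ n1 →
           P k j ≡ P k' j' → k ≡ k' × j ≡ j')
    (Z-sum : ∀ k j → 1 ≤ k → k ≤ m → 1 ≤ j → j ≤ n1 ∸ 1 → Z k j + Z k (suc j) ≡ a j)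
    (a-step : ∀ j → 1 ≤ j → suc j ≤ n1 ∸ 1 → a (suc j) ≡ a j + d)
    (a-last : a (n1 ∸ 1) + d ≡ N⁺)
    where

    Z≤N⁺ : ∀ k j → 1 ≤ k → k ≤ m → 1 ≤ j → j ≤ n1 → Z k j ≤ N⁺
    Z≤N⁺ k j k1 km j1 jn = ≤-trans (proj₂ (InPair-range (P-GVert k j k1 km j1 jn) (Z∈P k j k1 km j1 jn))) (n≤1+n N)

    swappedZ : ℕ → ℕ → ℕ
    swappedZ k j = if swapFixed j then compl (Z k j) else Z k (swapPos j)

    swappedZ-fixed : ∀ k j → swapFixed j ≡ true → swappedZ k j ≡ compl (Z k j)
    swappedZ-fixed k j e = cong (λ b → if b then compl (Z k j) else Z k (swapPos j)) e

    swappedZ-moved : ∀ k j → swapFixed j ≡ false → swappedZ k j ≡ Z k (swapPos j)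
    swappedZ-moved k j e = cong (λ b → if b then compl (Z k j) else Z k (swapPos j)) e

    swappedZ∈P-moved : ∀ k j → 1 ≤ k → k ≤ m → 1 ≤ j → j ≤ n1 → swapFixed j ≡ false →
      InPair m n (P k (swapPos j)) (swappedZ k j)
    swappedZ∈P-moved k j k1 km j1 jn moved = subst (InPair m n (P k (swapPos j))) (sym (swappedZ-moved k j moved))
      (Z∈P k (swapPos j) k1 km (proj₁ (swapPos-range j j1 jn)) (proj₂ (swapPos-range j j1 jn)))

    swappedZ∈P : ∀ k j → 1 ≤ k → k ≤ m → 1 ≤ j → j ≤ n1 → InPair m n (P k (swapPos j)) (swappedZ k j)
    swappedZ∈P k j k1 km j1 jn with swapView j
    ... | odd-fixed _ _ e fixed =
      subst (InPair m n (P k (swapPos j))) (sym (swappedZ-fixed k j fixed))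
        (subst (λ z → InPair m n (P k z) (compl (Z k j))) (sym e)
          (InPair-compl (GVert⇒≤N⁺ (P-GVert k j k1 km j1 jn)) (Z∈P k j k1 km j1 jn)))
    ... | odd-moves _ _ _ moved = swappedZ∈P-moved k j k1 km j1 jn moved
    ... | even-moves _ _ moved = swappedZ∈P-moved k j k1 km j1 jn moved

    swappedZ-sum-last : ∀ k j₀ → 1 ≤ k → k ≤ m → 1 ≤ j₀ → suc (suc j₀) ≡ n1 → swapFixed (suc (suc j₀)) ≡ true →
      Z k j₀ + compl (Z k (suc (suc j₀))) ≡ a (suc j₀)
    swappedZ-sum-last k j₀ k1 km j₀1 last fixed =
      +-cancelʳ-≡ d (A + compl C) (a (suc j₀))
        (begin
          A + compl C + d     ≡⟨ swap-last A (compl C) d ⟩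
          A + d + compl C     ≡⟨ cong (_+ compl C) (sym C≡A+d) ⟩
          C + compl C         ≡⟨ m+[n∸m]≡n (Z≤N⁺ k (suc (suc j₀)) k1 km (s≤s z≤n) (≤-reflexive last)) ⟩
          N⁺                  ≡⟨ sym a-last ⟩
          a (n1 ∸ 1) + d      ≡⟨ cong (λ z → a z + d) (sym j₀+1≡n1∸1) ⟩
          a (suc j₀) + d      ∎)
      where
      open ≡-Reasoning
      A = Z k j₀
      B = Z k (suc j₀)
      C = Z k (suc (suc j₀))
      j₀+1≡n1∸1 : suc j₀ ≡ n1 ∸ 1
      j₀+1≡n1∸1 = cong (_∸ 1) last
      j₀+1≤ : suc j₀ ≤ n1 ∸ 1
      j₀+1≤ = ≤-reflexive j₀+1≡n1∸1
      C≡A+d : C ≡ A + d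
      C≡A+d = +-cancelˡ-≡ B C (A + d)
        (begin
          B + C          ≡⟨ Z-sum k (suc j₀) k1 km (s≤s z≤n) j₀+1≤ ⟩
          a (suc j₀)     ≡⟨ a-step j₀ j₀1 j₀+1≤ ⟩
          a j₀ + d       ≡⟨ cong (_+ d) (sym (Z-sum k j₀ k1 km j₀1 (≤-trans (n≤1+n j₀) j₀+1≤))) ⟩
          A + B + d      ≡⟨ shuffle A B d ⟩
          B + (A + d)    ∎)
        where
        shuffle : ∀ x y z → x + y + z ≡ y + (x + z)
        shuffle = solve-∀
      swap-last : ∀ x y z → x + y + z ≡ x + z + y
      swap-last = solve-∀

    -- a_j + a_(j+2) = 2 a_(j+1), so skipping the swapped pair keeps the sum a_(j+1).
    swappedZ-sum-middle : ∀ k j₀ → 1 ≤ k → k ≤ m → 1 ≤ j₀ → suc (suc (suc j₀)) ≤ n1 →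
      Z k j₀ + Z k (suc (suc (suc j₀))) ≡ a (suc j₀)
    swappedZ-sum-middle k j₀ k1 km j₀1 j₀+3≤n1 =
      +-cancelʳ-≡ (a (suc j₀)) (A + D) (a (suc j₀))
        (begin
          A + D + a (suc j₀)          ≡⟨ cong ((A + D) +_) (sym (Z-sum k (suc j₀) k1 km (s≤s z≤n) j₀+1≤)) ⟩
          A + D + (B + C)             ≡⟨ regroup A B C D ⟩
          A + B + (C + D)             ≡⟨ cong₂ _+_ (Z-sum k j₀ k1 km j₀1 (≤-trans (n≤1+n j₀) j₀+1≤))
                                                  (Z-sum k (suc (suc j₀)) k1 km (s≤s z≤n) (<⇒≤pred j₀+3≤n1)) ⟩
          a j₀ + a (suc (suc j₀))     ≡⟨ cong (a j₀ +_) (a-step (suc j₀) (s≤s z≤n) (<⇒≤pred j₀+3≤n1)) ⟩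
          a j₀ + (a (suc j₀) + d)     ≡⟨ shuffle (a j₀) (a (suc j₀)) d ⟩
          a (suc j₀) + (a j₀ + d)     ≡⟨ cong (a (suc j₀) +_) (sym (a-step j₀ j₀1 j₀+1≤)) ⟩
          a (suc j₀) + a (suc j₀)     ∎)
      where
      open ≡-Reasoning
      A = Z k j₀
      B = Z k (suc j₀)
      C = Z k (suc (suc j₀))
      D = Z k (suc (suc (suc j₀)))
      j₀+1≤ : suc j₀ ≤ n1 ∸ 1
      j₀+1≤ = <⇒≤pred (≤-trans (n≤1+n (suc (suc j₀))) j₀+3≤n1)
      regroup : ∀ x y z w → x + w + (y + z) ≡ x + y + (z + w)
      regroup = solve-∀
      shuffle : ∀ x y z → x + (y + z) ≡ y + (x + z)
      shuffle = solve-∀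

    swappedZ-sum : ∀ k j → 1 ≤ k → k ≤ m → 1 ≤ j → j ≤ n1 ∸ 1 → swappedZ k j + swappedZ k (suc j) ≡ a j
    swappedZ-sum k j k1 km j1 j≤ with swapView j
    ... | odd-fixed _ j≡n1 _ _ = ⊥-elim (<⇒≢ (suc≤n1 j≤) j≡n1)
    ... | odd-moves odd? _ e moved with swapView (suc j)
    ...   | odd-moves odd?' _ _ _ = ⊥-elim (true≢false (trans (sym odd?') (isOdd-suc-of-odd j odd?)))
    ...   | odd-fixed odd?' _ _ _ = ⊥-elim (true≢false (trans (sym odd?') (isOdd-suc-of-odd j odd?)))
    ...   | even-moves _ e' moved' =
      trans (cong₂ _+_ (trans (swappedZ-moved k j moved) (cong (Z k) e)) (trans (swappedZ-moved k (suc j) moved') (cong (Z k) e')))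
            (trans (+-comm (Z k (suc j)) (Z k j)) (Z-sum k j k1 km j1 j≤))
    swappedZ-sum k (suc j₀) k1 km j1 j≤ | even-moves even? e moved with swapView (suc (suc j₀))
    ...   | even-moves even?' _ _ = ⊥-elim (true≢false (trans (sym (isOdd-of-even-suc (suc j₀) even?')) even?))
    ...   | odd-fixed _ last _ fixed =
      trans (cong₂ _+_ (trans (swappedZ-moved k (suc j₀) moved) (cong (Z k) e)) (swappedZ-fixed k (suc (suc j₀)) fixed))
            (swappedZ-sum-last k j₀ k1 km (≤-pred (even≥2 (suc j₀) j1 even?)) last fixed)
    ...   | odd-moves _ j₀+2≢n1 e' moved' =
      trans (cong₂ _+_ (trans (swappedZ-moved k (suc j₀) moved) (cong (Z k) e)) (trans (swappedZ-moved k (suc (suc j₀)) moved') (cong (Z k) e')))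
            (swappedZ-sum-middle k j₀ k1 km (≤-pred (even≥2 (suc j₀) j1 even?)) (≤∧≢⇒< (suc≤n1 j≤) j₀+2≢n1))

    vertexIndex : ℕ → ℕ
    vertexIndex e = P (suc (e / n1)) (suc (e % n1)) ∸ 1

    index-coordinates : ∀ e → e < H →
      (1 ≤ suc (e / n1) × suc (e / n1) ≤ m) × (1 ≤ suc (e % n1) × suc (e % n1) ≤ n1)
    index-coordinates e e<H = (s≤s z≤n , m<n*o⇒m/o<n e<H) , (s≤s z≤n , m%n<n e n1)

    vertexIndex-range : ∀ e → e < H → vertexIndex e < H
    vertexIndex-range e e<H with index-coordinates e e<H
    ... | (k1 , km) , (j1 , jn) with GVert⇒bounds (P-GVert _ _ k1 km j1 jn)
    ...   | p1 , p≤H = subst (_≤ H) (sym (suc-∸1 p1)) p≤H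

    vertexIndex-injective : ∀ x y → x < H → y < H → vertexIndex x ≡ vertexIndex y → x ≡ y
    vertexIndex-injective x y x<H y<H e with index-coordinates x x<H | index-coordinates y y<H
    ... | (k1 , km) , (j1 , jn) | (k1' , km') , (j1' , jn')
      with P-injective _ _ _ _ k1 km j1 jn k1' km' j1' jn'
             (trans (sym (suc-∸1 (proj₁ (GVert⇒bounds (P-GVert _ _ k1 km j1 jn)))))
               (trans (cong suc e) (suc-∸1 (proj₁ (GVert⇒bounds (P-GVert _ _ k1' km' j1' jn'))))))
    ...   | k≡ , j≡ = trans (m≡m%n+[m/n]*n x n1)
                        (trans (cong₂ (λ r q → r + q * n1) (suc-injective j≡) (suc-injective k≡)) (sym (m≡m%n+[m/n]*n y n1)))

    -- The m·n1 = H path vertices are distinct, so they exhaust the H vertices of G.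
    base-cover : ∀ q → GVert m n q → Σ ℕ λ k → Σ ℕ λ j → (1 ≤ k × k ≤ m) × (1 ≤ j × j ≤ n1) × P k j ≡ q
    base-cover q gq with GVert⇒bounds gq
    ... | q1 , q≤H with injective⇒surjective-< H vertexIndex vertexIndex-range vertexIndex-injective
                          (q ∸ 1) (subst (_≤ H) (sym (suc-∸1 q1)) q≤H)
    ...   | e , e<H , index≡ with index-coordinates e e<H
    ...     | (k1 , km) , (j1 , jn) = _ , _ , (k1 , km) , (j1 , jn) ,
      trans (sym (suc-∸1 (proj₁ (GVert⇒bounds (P-GVert _ _ k1 km j1 jn))))) (trans (cong suc index≡) (suc-∸1 q1))

    module _ (β : ℕ → Bool) where

      flipped : ℕ → ℕ → ℕ
      flipped k j = if β k then P k (swapPos j) else P k j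

      flippedZ : ℕ → ℕ → ℕ
      flippedZ k j = if β k then swappedZ k j else Z k j

      flipped-flip : ∀ k j → β k ≡ true → flipped k j ≡ P k (swapPos j)
      flipped-flip k j e = cong (λ b → if b then P k (swapPos j) else P k j) e

      flipped-keep : ∀ k j → β k ≡ false → flipped k j ≡ P k j
      flipped-keep k j e = cong (λ b → if b then P k (swapPos j) else P k j) e

      flipped-base : ∀ k j → 1 ≤ j → j ≤ n1 → Σ ℕ λ j₀ → (1 ≤ j₀ × j₀ ≤ n1) × flipped k j ≡ P k j₀
      flipped-base k j j1 jn with β k
      ... | true = swapPos j , swapPos-range j j1 jn , refl
      ... | false = j , (j1 , jn) , refl

      flippedZ-witness : ∀ k → 1 ≤ k → k ≤ m →
        (∀ j → 1 ≤ j → j ≤ n1 → InPair m n (flipped k j) (flippedZ k j))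
        × (∀ j → 1 ≤ j → j ≤ n1 ∸ 1 → flippedZ k j + flippedZ k (suc j) ≡ a j)
      flippedZ-witness k k1 km with β k
      ... | true = (λ j j1 jn → swappedZ∈P k j k1 km j1 jn) , (λ j j1 j≤ → swappedZ-sum k j k1 km j1 j≤)
      ... | false = (λ j j1 jn → Z∈P k j k1 km j1 jn) , (λ j j1 j≤ → Z-sum k j k1 km j1 j≤)

      flipped-GVert : ∀ k j → 1 ≤ k → k ≤ m → 1 ≤ j → j ≤ n1 → GVert m n (flipped k j)
      flipped-GVert k j k1 km j1 jn with flipped-base k j j1 jn
      ... | j₀ , (j₀1 , j₀n) , e = subst (GVert m n) (sym e) (P-GVert k j₀ k1 km j₀1 j₀n)

      flipped-injective : ∀ k j j' → 1 ≤ k → k ≤ m → 1 ≤ j → j ≤ n1 → 1 ≤ j' → j' ≤ n1 →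
        flipped k j ≡ flipped k j' → j ≡ j'
      flipped-injective k j j' k1 km j1 jn j1' jn' e with β k
      ... | true = trans (sym (swapPos-involutive j j1 jn))
                     (trans (cong swapPos (proj₂ (P-injective k (swapPos j) k (swapPos j') k1 km
                              (proj₁ (swapPos-range j j1 jn)) (proj₂ (swapPos-range j j1 jn)) k1 km
                              (proj₁ (swapPos-range j' j1' jn')) (proj₂ (swapPos-range j' j1' jn')) e)))
                            (swapPos-involutive j' j1' jn'))
      ... | false = proj₂ (P-injective k j k j' k1 km j1 jn k1 km j1' jn' e)

      flipped-path : ∀ k → 1 ≤ k → k ≤ m → AdmissiblePath m n n1 a (flipped k)
      flipped-path k k1 km =
        (λ j → flipped-GVert k j k1 km) , (λ j j' → flipped-injective k j j' k1 km) ,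
        flippedZ k , flippedZ-witness k k1 km

      flipped-disjoint : ∀ k k' j j' → 1 ≤ k → k ≤ m → 1 ≤ k' → k' ≤ m →
         1 ≤ j → j ≤ n1 → 1 ≤ j' → j' ≤ n1 → flipped k j ≡ flipped k' j' → k ≡ k'
      flipped-disjoint k k' j j' k1 km k1' km' j1 jn j1' jn' e
        with flipped-base k j j1 jn | flipped-base k' j' j1' jn'
      ... | j₀ , (j₀1 , j₀n) , e₀ | j₀' , (j₀1' , j₀n') , e₀' =
        proj₁ (P-injective k j₀ k' j₀' k1 km j₀1 j₀n k1' km' j₀1' j₀n' (trans (sym e₀) (trans e e₀')))

      flipped-cover : ∀ q → GVert m n q →
        Σ ℕ λ k → Σ ℕ λ j → (1 ≤ k × k ≤ m) × (1 ≤ j × j ≤ n1) × flipped k j ≡ q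
      flipped-cover q gq with base-cover q gq
      ... | k , j₀ , k-bounds , (j₀1 , j₀n) , e with β k in β≡
      ...   | true = k , swapPos j₀ , k-bounds , swapPos-range j₀ j₀1 j₀n ,
                       trans (flipped-flip k (swapPos j₀) β≡) (trans (cong (P k) (swapPos-involutive j₀ j₀1 j₀n)) e)
      ...   | false = k , j₀ , k-bounds , (j₀1 , j₀n) , trans (flipped-keep k j₀ β≡) e

      flipped-adjacent : ∀ p q → GVert m n p → GVert m n q → PathEdges m n1 flipped p q → GAdj m n (n1 ∸ 1) a p q
      flipped-adjacent p q gp gq (k , j , (k1 , km) , (j1 , j≤) , e) = distinct e , sums e
        where
        jn : j ≤ n1
        jn = ≤-trans (n≤1+n j) (suc≤n1 j≤)
        consecutive-≢ : flipped k j ≢ flipped k (suc j)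
        consecutive-≢ e' = 1+n≢n (sym (flipped-injective k j (suc j) k1 km j1 jn (s≤s z≤n) (suc≤n1 j≤) e'))
        distinct : UEdge p q (flipped k j) (flipped k (suc j)) → p ≢ q
        distinct (inj₁ (refl , refl)) = consecutive-≢
        distinct (inj₂ (refl , refl)) = λ e' → consecutive-≢ (sym e')
        witness = flippedZ-witness k k1 km
        sums : UEdge p q (flipped k j) (flipped k (suc j)) → Σ ℕ λ z₁ → Σ ℕ λ z₂ → Σ ℕ λ k' →
              InPair m n p z₁ × InPair m n q z₂ × (1 ≤ k' × k' ≤ n1 ∸ 1) × z₁ + z₂ ≡ a k'
        sums (inj₁ (refl , refl)) =
          flippedZ k j , flippedZ k (suc j) , j ,
          proj₁ witness j j1 jn , proj₁ witness (suc j) (s≤s z≤n) (suc≤n1 j≤) , (j1 , j≤) , proj₂ witness j j1 j≤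
        sums (inj₂ (refl , refl)) =
          flippedZ k (suc j) , flippedZ k j , j ,
          proj₁ witness (suc j) (s≤s z≤n) (suc≤n1 j≤) , proj₁ witness j j1 jn , (j1 , j≤) ,
          trans (+-comm (flippedZ k (suc j)) (flippedZ k j)) (proj₂ witness j j1 j≤)

      flipped-partition : AdmPathPartition m n a (PathEdges m n1 flipped)
      flipped-partition =
        flipped , flipped-path , flipped-disjoint , flipped-cover , flipped-adjacent ,
        (λ p q gp gq → (λ e → e) , (λ e → e))

    -- The flipped path k reads P k 2, P k 1, P k 4, P k 3, …, so the edge P k 2 — P k 3 detects β k.
    edge-of-kept : ∀ β k → β k ≡ false → 1 ≤ k → k ≤ m → PathEdges m n1 (flipped β) (P k 2) (P k 3)
    edge-of-kept β k kept k1 km =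
      k , 2 , (k1 , km) , (s≤s z≤n , <⇒≤pred n1≥3) , inj₁ (sym (flipped-keep β k 2 kept) , sym (flipped-keep β k 3 kept))

    no-edge-of-flipped : ∀ β k → β k ≡ true → 1 ≤ k → k ≤ m → ¬ PathEdges m n1 (flipped β) (P k 2) (P k 3)
    no-edge-of-flipped β k flip k1 km (k' , j , (k1' , km') , (j1 , j≤) , e) = impossible (β k') refl e
      where
      jn : j ≤ n1
      jn = ≤-trans (n≤1+n j) (suc≤n1 j≤)
      2≤n1 : 2 ≤ n1
      2≤n1 = ≤-trans (n≤1+n 2) n1≥3
      position-of-2 : ∀ j' → 1 ≤ j' → j' ≤ n1 → P k 2 ≡ P k' (swapPos j') → j' ≡ 1
      position-of-2 j' j1' jn' e' =
        trans (sym (swapPos-involutive j' j1' jn'))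
          (trans (cong swapPos (sym (proj₂ (P-injective k 2 k' (swapPos j') k1 km (s≤s z≤n) 2≤n1 k1' km'
                   (proj₁ (swapPos-range j' j1' jn')) (proj₂ (swapPos-range j' j1' jn')) e')))) swapPos-2)
      impossible : ∀ b → β k' ≡ b → UEdge (P k 2) (P k 3) (flipped β k' j) (flipped β k' (suc j)) → ⊥
      impossible false kept (inj₁ (e₂ , _)) =
        true≢false (trans (sym flip) (trans (cong β (proj₁ (P-injective k 2 k' j k1 km (s≤s z≤n) 2≤n1 k1' km' j1 jn
          (trans e₂ (flipped-keep β k' j kept))))) kept))
      impossible false kept (inj₂ (e₂ , _)) =
        true≢false (trans (sym flip) (trans (cong β (proj₁ (P-injective k 2 k' (suc j) k1 km (s≤s z≤n) 2≤n1 k1' km'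
          (s≤s z≤n) (suc≤n1 j≤) (trans e₂ (flipped-keep β k' (suc j) kept))))) kept))
      impossible true flip' (inj₁ (e₂ , e₃)) = three≢one (trans 3≡ (cong swapPos (cong suc j≡1)))
        where
        three≢one : 3 ≢ 1
        three≢one ()
        j≡1 : j ≡ 1
        j≡1 = position-of-2 j j1 jn (trans e₂ (flipped-flip β k' j flip'))
        3≡ : 3 ≡ swapPos (suc j)
        3≡ = proj₂ (P-injective k 3 k' (swapPos (suc j)) k1 km (s≤s z≤n) n1≥3 k1' km'
               (proj₁ (swapPos-range (suc j) (s≤s z≤n) (suc≤n1 j≤))) (proj₂ (swapPos-range (suc j) (s≤s z≤n) (suc≤n1 j≤)))
               (trans e₃ (flipped-flip β k' (suc j) flip')))
      impossible true flip' (inj₂ (e₂ , _)) =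
        <⇒≢ j1 (sym (suc-injective (position-of-2 (suc j) (s≤s z≤n) (suc≤n1 j≤) (trans e₂ (flipped-flip β k' (suc j) flip')))))

    same-graph⇒same-flips : ∀ β β' → SameGraph m n (PathEdges m n1 (flipped β)) (PathEdges m n1 (flipped β')) →
      ∀ k → 1 ≤ k → k ≤ m → β k ≡ β' k
    same-graph⇒same-flips β β' same k k1 km = by-flips (β k) (β' k) refl refl
      where
      same₂₃ = same (P k 2) (P k 3) (P-GVert k 2 k1 km (s≤s z≤n) (≤-trans (n≤1+n 2) n1≥3)) (P-GVert k 3 k1 km (s≤s z≤n) n1≥3)
      by-flips : ∀ b b' → β k ≡ b → β' k ≡ b' → β k ≡ β' k
      by-flips true true e e' = trans e (sym e')
      by-flips false false e e' = trans e (sym e')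
      by-flips false true e e' = ⊥-elim (no-edge-of-flipped β' k e' k1 km (proj₁ same₂₃ (edge-of-kept β k e k1 km)))
      by-flips true false e e' = ⊥-elim (no-edge-of-flipped β k e k1 km (proj₂ same₂₃ (edge-of-kept β' k e' k1 km)))

    flippedPartitions : DistinctPartitions m n a
    flippedPartitions =
      (λ t → PathEdges m n1 (flipped (bit (toℕ t)))) , (λ t → flipped-partition (bit (toℕ t))) ,
      λ t t' t≢t' same → t≢t' (toℕ-injective (bits-determine-code m (toℕ t) (toℕ t') (toℕ<n t) (toℕ<n t')
        (same-graph⇒same-flips (bit (toℕ t)) (bit (toℕ t')) same)))

-- Position 2t+1 of path k carries c k + d·t and position 2t the partner of c k + d·(n1 - t):
-- consecutive sums then form the arithmetic sequence with a_j + d·(n1 - j) = mn + 1.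
module ArithmeticWitnesses (m n : ℕ) (m≥3 : 3 ≤ m) (m-odd : m % 2 ≡ 1) (n≥6 : 6 ≤ n) (n-even : n % 2 ≡ 0)
  (a c : ℕ → ℕ) (d : ℕ) where

  open LabelPairs m n m≥3 m-odd n≥6 n-even

  arithZ : ℕ → ℕ → ℕ
  arithZ k j = if isOdd j then c k + d * ⌊ j /2⌋ else N⁺ ∸ (c k + d * (n1 ∸ ⌊ j /2⌋))

  arithZ-isOdd : ∀ k j → isOdd j ≡ true → arithZ k j ≡ c k + d * ⌊ j /2⌋
  arithZ-isOdd k j e = cong (λ b → if b then c k + d * ⌊ j /2⌋ else N⁺ ∸ (c k + d * (n1 ∸ ⌊ j /2⌋))) e

  arithZ-isEven : ∀ k j → isOdd j ≡ false → arithZ k j ≡ N⁺ ∸ (c k + d * (n1 ∸ ⌊ j /2⌋))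
  arithZ-isEven k j e = cong (λ b → if b then c k + d * ⌊ j /2⌋ else N⁺ ∸ (c k + d * (n1 ∸ ⌊ j /2⌋))) e

  arithZ-odd : ∀ k t → arithZ k (suc (t + t)) ≡ c k + d * t
  arithZ-odd k t = trans (arithZ-isOdd k _ (isOdd-suc-double t)) (cong (λ z → c k + d * z) (⌊1+n+n/2⌋≡n t))

  arithZ-even : ∀ k t → arithZ k (t + t) ≡ N⁺ ∸ (c k + d * (n1 ∸ t))
  arithZ-even k t = trans (arithZ-isEven k _ (isOdd-double t)) (cong (λ z → N⁺ ∸ (c k + d * (n1 ∸ z))) (⌊n+n/2⌋≡n t))

  module Sums
    (a-complement : ∀ j r → 1 ≤ j → 1 ≤ r → j + r ≡ n1 → a j + d * r ≡ N⁺)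
    (c-bound : ∀ k t → 1 ≤ k → k ≤ m → 1 ≤ t → t + t ≤ n1 → c k + d * (n1 ∸ t) ≤ N⁺)
    where

    arithZ-sum-odd : ∀ k t → 1 ≤ k → k ≤ m → suc (suc (t + t)) ≤ n1 →
      arithZ k (suc (t + t)) + arithZ k (suc (suc (t + t))) ≡ a (suc (t + t))
    arithZ-sum-odd k t k1 km sjn = +-cancelʳ-≡ (d * r) _ _
        (trans (cong (λ z → z + d * r) (cong₂ _+_ (arithZ-odd k t) ze))
          (trans (rr (c k) d t r W) (trans (m+[n∸m]≡n Yle) (sym (a-complement jj r (s≤s z≤n) r1 jr)))))
      where
      jj = suc (t + t)
      r = n1 ∸ jj
      jr : jj + r ≡ n1
      jr = m+[n∸m]≡n (≤-trans (n≤1+n jj) sjn)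
      r1 : 1 ≤ r
      r1 = m<n⇒0<n∸m sjn
      n1∸st : n1 ∸ suc t ≡ t + r
      n1∸st = trans (cong (_∸ suc t) (sym jr)) (trans (cong (_∸ suc t) (l t r)) (m+n∸m≡n (suc t) (t + r)))
        where
        l : ∀ x y → suc (x + x) + y ≡ suc x + (x + y)
        l = solve-∀
      Y = c k + d * (t + r)
      Yle : Y ≤ N⁺
      Yle = subst (λ z → c k + d * z ≤ N⁺) n1∸st (c-bound k (suc t) k1 km (s≤s z≤n) (subst (_≤ n1) (cong suc (sym (+-suc t t))) sjn))
      W = N⁺ ∸ Y
      ze : arithZ k (suc (suc (t + t))) ≡ W
      ze = trans (cong (arithZ k) (cong suc (sym (+-suc t t)))) (trans (arithZ-even k (suc t)) (cong (λ z → N⁺ ∸ (c k + d * z)) n1∸st))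
      rr : ∀ C D T R V → C + D * T + V + D * R ≡ (C + D * (T + R)) + V
      rr = solve-∀

    arithZ-sum-even : ∀ k t → 1 ≤ k → k ≤ m → 1 ≤ t → suc (t + t) ≤ n1 →
      arithZ k (t + t) + arithZ k (suc (t + t)) ≡ a (t + t)
    arithZ-sum-even k t k1 km t1 sjn = +-cancelʳ-≡ (d * r) _ _
        (trans (cong (λ z → z + d * r) (cong₂ _+_ ze (arithZ-odd k t)))
          (trans (rr (c k) d t r W) (trans (m+[n∸m]≡n Yle) (sym (a-complement jj r (≤-trans t1 (m≤m+n t t)) r1 jr)))))
      where
      jj = t + t
      r = n1 ∸ jj
      jr : jj + r ≡ n1
      jr = m+[n∸m]≡n (≤-trans (n≤1+n jj) sjn)
      r1 : 1 ≤ r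
      r1 = m<n⇒0<n∸m sjn
      n1∸t : n1 ∸ t ≡ t + r
      n1∸t = trans (cong (_∸ t) (sym jr)) (trans (cong (_∸ t) (+-assoc t t r)) (m+n∸m≡n t (t + r)))
      Y = c k + d * (t + r)
      Yle : Y ≤ N⁺
      Yle = subst (λ z → c k + d * z ≤ N⁺) n1∸t (c-bound k t k1 km t1 (≤-trans (n≤1+n jj) sjn))
      W = N⁺ ∸ Y
      ze : arithZ k (t + t) ≡ W
      ze = trans (arithZ-even k t) (cong (λ z → N⁺ ∸ (c k + d * z)) n1∸t)
      rr : ∀ C D T R V → V + (C + D * T) + D * R ≡ (C + D * (T + R)) + V
      rr = solve-∀

    arithZ-sum : ∀ k j → 1 ≤ k → k ≤ m → 1 ≤ j → j ≤ n1 ∸ 1 → arithZ k j + arithZ k (suc j) ≡ a j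
    arithZ-sum k j k1 km j1 jn0 with parityView j
    ... | odd t refl = arithZ-sum-odd k t k1 km (suc≤n1 jn0)
    ... | even zero refl = ⊥-elim (<⇒≱ j1 z≤n)
    ... | even (suc t) refl = arithZ-sum-even k (suc t) k1 km (s≤s z≤n) (suc≤n1 jn0)

    a-step : ∀ j → 1 ≤ j → suc j ≤ n1 ∸ 1 → a (suc j) ≡ a j + d
    a-step j j1 sjn0 = +-cancelʳ-≡ (d * r) _ _ (trans (a-complement (suc j) r (s≤s z≤n) r1 jr) (trans (sym (a-complement j (suc r) j1 (s≤s z≤n) jr')) (trans (cong (a j +_) (*-suc d r)) (sym (+-assoc (a j) d (d * r))))))
      where
      r = n1 ∸ suc j
      ssj : suc (suc j) ≤ n1
      ssj = suc≤n1 sjn0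
      jr : suc j + r ≡ n1
      jr = m+[n∸m]≡n (≤-trans (n≤1+n _) ssj)
      r1 : 1 ≤ r
      r1 = m<n⇒0<n∸m ssj
      jr' : j + suc r ≡ n1
      jr' = trans (+-suc j r) jr

    a-last : a (n1 ∸ 1) + d ≡ N⁺
    a-last = trans (cong (a (n1 ∸ 1) +_) (sym (*-identityʳ d))) (a-complement (n1 ∸ 1) 1 (≤-trans (s≤s z≤n) (<⇒≤pred (≤-trans (s≤s (s≤s z≤n)) n1≥3))) ≤-refl (trans (+-comm (n1 ∸ 1) 1) (suc-∸1 n1≥1)))

module Sequences (m n : ℕ) (m≥3 : 3 ≤ m) (m-odd : m % 2 ≡ 1) (n≥6 : 6 ≤ n) (n-even : n % 2 ≡ 0) where

  open LabelPairs m n m≥3 m-odd n≥6 n-even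

  instance
    m-nonZero : NonZero m
    m-nonZero = >-nonZero m≥1

  slot : ℕ → ℕ
  slot j = if isOdd j then ⌊ j /2⌋ else n1 ∸ ⌊ j /2⌋

  slot-isOdd : ∀ j → isOdd j ≡ true → slot j ≡ ⌊ j /2⌋
  slot-isOdd j e = cong (λ b → if b then ⌊ j /2⌋ else n1 ∸ ⌊ j /2⌋) e

  slot-isEven : ∀ j → isOdd j ≡ false → slot j ≡ n1 ∸ ⌊ j /2⌋
  slot-isEven j e = cong (λ b → if b then ⌊ j /2⌋ else n1 ∸ ⌊ j /2⌋) e

  slot-odd : ∀ t → slot (suc (t + t)) ≡ t
  slot-odd t = trans (slot-isOdd (suc (t + t)) (isOdd-suc-double t)) (⌊1+n+n/2⌋≡n t)

  slot-even : ∀ t → slot (t + t) ≡ n1 ∸ t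
  slot-even t = trans (slot-isEven (t + t) (isOdd-double t)) (cong (n1 ∸_) (⌊n+n/2⌋≡n t))

  slot<n1 : ∀ j → 1 ≤ j → j ≤ n1 → slot j < n1
  slot<n1 j j1 jn with parityView j
  ... | odd t refl = subst (_< n1) (sym (slot-odd t)) (≤-trans (s≤s (m≤m+n t t)) jn)
  ... | even zero refl = ⊥-elim (<⇒≱ j1 z≤n)
  ... | even (suc t) refl =
    subst (_< n1) (sym (slot-even (suc t))) (∸-monoʳ-< {n1} {suc t} {0} (s≤s z≤n) (≤-trans (m≤m+n (suc t) (suc t)) jn))

  odd-slot≢even-slot : ∀ t t' → suc (t + t) ≤ n1 → t' + t' ≤ n1 → t ≢ n1 ∸ t'
  odd-slot≢even-slot t t' odd≤ even≤ t≡ =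
    <⇒≱ (subst (_≤ n1 + n1) (regroup t t') (+-mono-≤ odd≤ even≤)) (≤-reflexive (cong (λ z → z + z) (sym t+t'≡n1)))
    where
    t+t'≡n1 : t + t' ≡ n1
    t+t'≡n1 = trans (cong (_+ t') t≡) (m∸n+n≡m (≤-trans (m≤n+m t' t') even≤))
    regroup : ∀ x y → suc (x + x) + (y + y) ≡ suc ((x + y) + (x + y))
    regroup = solve-∀

  slot-injective : ∀ j j' → 1 ≤ j → j ≤ n1 → 1 ≤ j' → j' ≤ n1 → slot j ≡ slot j' → j ≡ j'
  slot-injective j j' j1 jn j1' jn' e with parityView j | parityView j'
  ... | odd t refl | odd t' refl = cong (λ z → suc (z + z)) (trans (sym (slot-odd t)) (trans e (slot-odd t')))
  ... | even t refl | even t' refl =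
    cong (λ z → z + z) (∸-cancelˡ-≡ (≤-trans (m≤m+n t t) jn) (≤-trans (m≤m+n t' t') jn')
                                    (trans (sym (slot-even t)) (trans e (slot-even t'))))
  ... | odd t refl | even t' refl = ⊥-elim (odd-slot≢even-slot t t' jn jn' (trans (sym (slot-odd t)) (trans e (slot-even t'))))
  ... | even t refl | odd t' refl = ⊥-elim (odd-slot≢even-slot t' t jn' jn (trans (sym (slot-odd t')) (trans (sym e) (slot-even t))))

  m+m*[n1∸1]≡H : m + m * (n1 ∸ 1) ≡ H
  m+m*[n1∸1]≡H = trans (sym (*-suc m (n1 ∸ 1))) (cong (m *_) (suc-∸1 n1≥1))

  module SlotVertices (a c : ℕ → ℕ) (d : ℕ) where

    open ArithmeticWitnesses m n m≥3 m-odd n≥6 n-even a c d public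

    slotVertex : ℕ → ℕ → ℕ
    slotVertex k j = c k + d * slot j

    arithZ∈slotVertex : ∀ k j → InPair m n (slotVertex k j) (arithZ k j)
    arithZ∈slotVertex k j = by-parity (isOdd j) refl
      where
      by-parity : ∀ b → isOdd j ≡ b → InPair m n (slotVertex k j) (arithZ k j)
      by-parity true odd? = inj₁ (trans (arithZ-isOdd k j odd?)
        (cong (λ z → c k + d * z) (sym (slot-isOdd j odd?))))
      by-parity false even? = inj₂ (trans (arithZ-isEven k j even?)
        (cong (λ z → N⁺ ∸ (c k + d * z)) (sym (slot-isEven j even?))))

  module Sequence1 where

    a1 : ℕ → ℕ
    a1 = seqA m n seq1

    c1 : ℕ → ℕ
    c1 k = (k ∸ 1) * n1 + 1

    open SlotVertices a1 c1 1

    a-complement : ∀ j r → 1 ≤ j → 1 ≤ r → j + r ≡ n1 → a1 j + 1 * r ≡ N⁺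
    a-complement j r _ _ j+r≡n1 =
      begin
        N ∸ (n1 ∸ 1) + j + 1 * r   ≡⟨ regroup (N ∸ (n1 ∸ 1)) j r ⟩
        N ∸ (n1 ∸ 1) + (j + r)     ≡⟨ cong (N ∸ (n1 ∸ 1) +_) (trans j+r≡n1 (sym (suc-∸1 n1≥1))) ⟩
        N ∸ (n1 ∸ 1) + suc (n1 ∸ 1) ≡⟨ +-suc (N ∸ (n1 ∸ 1)) (n1 ∸ 1) ⟩
        suc (N ∸ (n1 ∸ 1) + (n1 ∸ 1)) ≡⟨ cong suc (m∸n+n≡m n1∸1≤N) ⟩
        N⁺                         ∎
      where
      open ≡-Reasoning
      n1∸1≤N : n1 ∸ 1 ≤ N
      n1∸1≤N = ≤-trans (m∸n≤m n1 1) (≤-trans (m≤n*m n1 m) H≤N)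
      regroup : ∀ x y z → x + y + 1 * z ≡ x + (y + z)
      regroup = solve-∀

    block-bound : ∀ k x → 1 ≤ k → k ≤ m → x ≤ n1 → (k ∸ 1) * n1 + x ≤ H
    block-bound k x k1 km x≤n1 = ≤-trans (+-monoʳ-≤ ((k ∸ 1) * n1) x≤n1)
      (subst (_≤ H) (+-comm n1 ((k ∸ 1) * n1)) (subst (λ z → z * n1 ≤ H) (sym (suc-∸1 k1)) (*-monoˡ-≤ n1 km)))

    c-bound : ∀ k t → 1 ≤ k → k ≤ m → 1 ≤ t → t + t ≤ n1 → c1 k + 1 * (n1 ∸ t) ≤ N⁺
    c-bound k t k1 km t1 t+t≤n1 =
      ≤-trans (subst (_≤ H) (sym (+-assoc ((k ∸ 1) * n1) 1 (1 * (n1 ∸ t)))) (block-bound k (1 + 1 * (n1 ∸ t)) k1 km x≤n1)) H≤N⁺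
      where
      x≤n1 : 1 + 1 * (n1 ∸ t) ≤ n1
      x≤n1 = subst (λ z → suc z ≤ n1) (sym (*-identityˡ (n1 ∸ t))) (∸-monoʳ-< {n1} {t} {0} t1 (≤-trans (m≤m+n t t) t+t≤n1))

    slotVertex-GVert : ∀ k j → 1 ≤ k → k ≤ m → 1 ≤ j → j ≤ n1 → GVert m n (slotVertex k j)
    slotVertex-GVert k j k1 km j1 jn = bounds⇒GVert (≤-trans (m≤n+m 1 ((k ∸ 1) * n1)) (m≤m+n _ _))
      (subst (_≤ H) (sym (+-assoc ((k ∸ 1) * n1) 1 (1 * slot j)))
        (block-bound k (1 + 1 * slot j) k1 km (subst (λ z → suc z ≤ n1) (sym (*-identityˡ (slot j))) (slot<n1 j j1 jn))))

    slotVertex≡ : ∀ k j → slotVertex k j ≡ suc (slot j + n1 * (k ∸ 1))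
    slotVertex≡ k j = normalise (k ∸ 1) n1 (slot j)
      where
      normalise : ∀ K N1 E → K * N1 + 1 + 1 * E ≡ suc (E + N1 * K)
      normalise = solve-∀

    slotVertex-injective : ∀ k j k' j' → 1 ≤ k → k ≤ m → 1 ≤ j → j ≤ n1 → 1 ≤ k' → k' ≤ m → 1 ≤ j' → j' ≤ n1 →
      slotVertex k j ≡ slotVertex k' j' → k ≡ k' × j ≡ j'
    slotVertex-injective k j k' j' k1 km j1 jn k1' km' j1' jn' e
      with digits-unique n1 (slot j) (slot j') (k ∸ 1) (k' ∸ 1) (slot<n1 j j1 jn) (slot<n1 j' j1' jn')
             (suc-injective (trans (sym (slotVertex≡ k j)) (trans e (slotVertex≡ k' j'))))
    ... | slot≡ , k∸1≡ = trans (sym (suc-∸1 k1)) (trans (cong suc k∸1≡) (suc-∸1 k1')) , slot-injective j j' j1 jn j1' jn' slot≡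

    open Sums a-complement c-bound
    open Flips m n m≥3 m-odd n≥6 n-even a1 1 slotVertex arithZ

    partitions : DistinctPartitions m n a1
    partitions = Flipping.flippedPartitions (λ k j _ _ _ _ → arithZ∈slotVertex k j)
                   slotVertex-GVert slotVertex-injective arithZ-sum a-step a-last

  module Sequence2 where

    a2 : ℕ → ℕ
    a2 = seqA m n seq2

    open SlotVertices a2 (λ k → k) m

    a-complement : ∀ j r → 1 ≤ j → 1 ≤ r → j + r ≡ n1 → a2 j + m * r ≡ N⁺
    a-complement j r _ _ j+r≡n1 =
      trans (regroup m n1 j r) (cong suc (trans (cong (λ z → m * (n1 + z)) j+r≡n1) (cong (m *_) (sym n≡n1+n1))))
      where
      regroup : ∀ M N1 J R → M * (N1 + J) + 1 + M * R ≡ suc (M * (N1 + (J + R)))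
      regroup = solve-∀

    vertex-bound : ∀ k x → k ≤ m → x ≤ n1 ∸ 1 → k + m * x ≤ H
    vertex-bound k x km x≤ = subst (k + m * x ≤_) m+m*[n1∸1]≡H (+-mono-≤ km (*-monoʳ-≤ m x≤))

    c-bound : ∀ k t → 1 ≤ k → k ≤ m → 1 ≤ t → t + t ≤ n1 → k + m * (n1 ∸ t) ≤ N⁺
    c-bound k t k1 km t1 _ = ≤-trans (vertex-bound k (n1 ∸ t) km (∸-monoʳ-≤ n1 t1)) H≤N⁺

    slotVertex-GVert : ∀ k j → 1 ≤ k → k ≤ m → 1 ≤ j → j ≤ n1 → GVert m n (slotVertex k j)
    slotVertex-GVert k j k1 km j1 jn =
      bounds⇒GVert (≤-trans k1 (m≤m+n k _)) (vertex-bound k (slot j) km (<⇒≤pred (slot<n1 j j1 jn)))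

    slotVertex-injective : ∀ k j k' j' → 1 ≤ k → k ≤ m → 1 ≤ j → j ≤ n1 → 1 ≤ k' → k' ≤ m → 1 ≤ j' → j' ≤ n1 →
      slotVertex k j ≡ slotVertex k' j' → k ≡ k' × j ≡ j'
    slotVertex-injective k j k' j' k1 km j1 jn k1' km' j1' jn' e
      with digits-unique m (k ∸ 1) (k' ∸ 1) (slot j) (slot j')
             (subst (_≤ m) (sym (suc-∸1 k1)) km) (subst (_≤ m) (sym (suc-∸1 k1')) km')
             (suc-injective (trans (cong (_+ m * slot j) (suc-∸1 k1)) (trans e (cong (_+ m * slot j') (sym (suc-∸1 k1'))))))
    ... | k∸1≡ , slot≡ = trans (sym (suc-∸1 k1)) (trans (cong suc k∸1≡) (suc-∸1 k1')) , slot-injective j j' j1 jn j1' jn' slot≡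

    open Sums a-complement c-bound
    open Flips m n m≥3 m-odd n≥6 n-even a2 m slotVertex arithZ

    partitions : DistinctPartitions m n a2
    partitions = Flipping.flippedPartitions (λ k j _ _ _ _ → arithZ∈slotVertex k j)
                   slotVertex-GVert slotVertex-injective arithZ-sum a-step a-last

  module Sequence3 where

    a3 : ℕ → ℕ
    a3 = seqA m n seq3

    open ArithmeticWitnesses m n m≥3 m-odd n≥6 n-even a3 (λ k → k) (2 * m)

    a-complement : ∀ j r → 1 ≤ j → 1 ≤ r → j + r ≡ n1 → a3 j + 2 * m * r ≡ N⁺
    a-complement j r _ _ j+r≡n1 =
      trans (regroup m j r) (cong suc (trans (cong (λ z → 2 * m * z) j+r≡n1) (trans (double m n1) (sym N≡H+H))))
      where
      regroup : ∀ M J R → 2 * M * J + 1 + 2 * M * R ≡ suc (2 * M * (J + R))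
      regroup = solve-∀
      double : ∀ M N1 → 2 * M * N1 ≡ M * N1 + M * N1
      double = solve-∀

    c-bound : ∀ k t → 1 ≤ k → k ≤ m → 1 ≤ t → t + t ≤ n1 → k + 2 * m * (n1 ∸ t) ≤ N⁺
    c-bound k t k1 km t1 _ =
      ≤-trans (+-mono-≤ km (*-monoʳ-≤ (2 * m) (∸-monoʳ-≤ n1 t1))) (≤-trans largest≤N (n≤1+n N))
      where
      regroup : ∀ M X → M + (M + 2 * M * X) ≡ (M + M * X) + (M + M * X)
      regroup = solve-∀
      largest≤N : m + 2 * m * (n1 ∸ 1) ≤ N
      largest≤N = ≤-trans (m≤n+m (m + 2 * m * (n1 ∸ 1)) m)
                    (≤-reflexive (trans (regroup m (n1 ∸ 1)) (trans (cong (λ z → z + z) m+m*[n1∸1]≡H) (sym N≡H+H))))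

    zigzagOffset : ℕ → ℕ → ℕ
    zigzagOffset k j = if isOdd j then k ∸ 1 else m ∸ k

    zigzagOffset-odd : ∀ k j → isOdd j ≡ true → zigzagOffset k j ≡ k ∸ 1
    zigzagOffset-odd k j e = cong (λ b → if b then k ∸ 1 else m ∸ k) e

    zigzagOffset-even : ∀ k j → isOdd j ≡ false → zigzagOffset k j ≡ m ∸ k
    zigzagOffset-even k j e = cong (λ b → if b then k ∸ 1 else m ∸ k) e

    zigzagVertex : ℕ → ℕ → ℕ
    zigzagVertex k j = suc (zigzagOffset k j + m * (j ∸ 1))

    zigzagOffset<m : ∀ k j → 1 ≤ k → k ≤ m → zigzagOffset k j < m
    zigzagOffset<m k j k1 km = by-parity (isOdd j) refl
      where
      by-parity : ∀ b → isOdd j ≡ b → zigzagOffset k j < m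
      by-parity true e = subst (_< m) (sym (zigzagOffset-odd k j e)) (subst (_≤ m) (sym (suc-∸1 k1)) km)
      by-parity false e = subst (_< m) (sym (zigzagOffset-even k j e)) (∸-monoʳ-< {m} {k} {0} k1 km)

    zigzagVertex-GVert : ∀ k j → 1 ≤ k → k ≤ m → 1 ≤ j → j ≤ n1 → GVert m n (zigzagVertex k j)
    zigzagVertex-GVert k j k1 km j1 jn = bounds⇒GVert (s≤s z≤n)
      (subst (zigzagVertex k j ≤_) m+m*[n1∸1]≡H (+-mono-≤ (zigzagOffset<m k j k1 km) (*-monoʳ-≤ m (∸-monoˡ-≤ 1 jn))))

    zigzagVertex-injective : ∀ k j k' j' → 1 ≤ k → k ≤ m → 1 ≤ j → j ≤ n1 → 1 ≤ k' → k' ≤ m → 1 ≤ j' → j' ≤ n1 →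
      zigzagVertex k j ≡ zigzagVertex k' j' → k ≡ k' × j ≡ j'
    zigzagVertex-injective k j k' j' k1 km j1 jn k1' km' j1' jn' e
      with digits-unique m (zigzagOffset k j) (zigzagOffset k' j') (j ∸ 1) (j' ∸ 1)
             (zigzagOffset<m k j k1 km) (zigzagOffset<m k' j' k1' km') (suc-injective e)
    ... | offset≡ , j∸1≡ with trans (sym (suc-∸1 j1)) (trans (cong suc j∸1≡) (suc-∸1 j1'))
    ...   | refl = by-parity (isOdd j) refl , refl
      where
      by-parity : ∀ b → isOdd j ≡ b → k ≡ k'
      by-parity true odd? = trans (sym (suc-∸1 k1)) (trans (cong suc
        (trans (sym (zigzagOffset-odd k j odd?)) (trans offset≡ (zigzagOffset-odd k' j odd?)))) (suc-∸1 k1'))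
      by-parity false even? = ∸-cancelˡ-≡ km km'
        (trans (sym (zigzagOffset-even k j even?)) (trans offset≡ (zigzagOffset-even k' j even?)))

    arithZ∈zigzagVertex : ∀ k j → 1 ≤ k → k ≤ m → 1 ≤ j → j ≤ n1 → InPair m n (zigzagVertex k j) (arithZ k j)
    arithZ∈zigzagVertex k j k1 km j1 jn with parityView j
    ... | odd t refl = inj₁ (trans (arithZ-odd k t) (trans (cong (λ z → z + 2 * m * t) (sym (suc-∸1 k1)))
            (trans (regroup (k ∸ 1) m t)
              (cong (λ z → suc (z + m * (t + t))) (sym (zigzagOffset-odd k (suc (t + t)) (isOdd-suc-double t)))))))
      where
      regroup : ∀ K M T → suc K + 2 * M * T ≡ suc (K + M * (T + T))
      regroup = solve-∀
    ... | even zero refl = ⊥-elim (<⇒≱ j1 z≤n)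
    ... | even (suc t) refl = inj₁ (trans (arithZ-even k (suc t))
            (trans (trans (cong (_∸ (k + 2 * m * q)) N⁺≡) (m+n∸n≡m _ (k + 2 * m * q)))
              (cong (λ z → suc (z + m * (t + suc t))) (sym (zigzagOffset-even k (suc t + suc t) (isOdd-double (suc t)))))))
      where
      q = n1 ∸ suc t
      g = m ∸ k
      k+g≡m : k + g ≡ m
      k+g≡m = m+[n∸m]≡n km
      t+q≡n1 : suc t + q ≡ n1
      t+q≡n1 = m+[n∸m]≡n (≤-trans (m≤m+n (suc t) (suc t)) jn)
      regroup : ∀ K G T Q → suc ((K + G) * (suc T + Q) + (K + G) * (suc T + Q))
                             ≡ suc (G + (K + G) * (T + suc T)) + (K + 2 * (K + G) * Q)
      regroup = solve-∀
      N⁺≡ : N⁺ ≡ suc (g + m * (t + suc t)) + (k + 2 * m * q)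
      N⁺≡ = trans (cong suc N≡H+H)
              (subst₂ (λ M Q → suc (M * Q + M * Q) ≡ suc (g + M * (t + suc t)) + (k + 2 * M * q)) k+g≡m t+q≡n1 (regroup k g t q))

    open Sums a-complement c-bound
    open Flips m n m≥3 m-odd n≥6 n-even a3 (2 * m) zigzagVertex arithZ

    partitions : DistinctPartitions m n a3
    partitions = Flipping.flippedPartitions arithZ∈zigzagVertex zigzagVertex-GVert zigzagVertex-injective
                   arithZ-sum a-step a-last

  partitions : (s : SeqChoice) → DistinctPartitions m n (seqA m n s)
  partitions seq1 = Sequence1.partitions
  partitions seq2 = Sequence2.partitions
  partitions seq3 = Sequence3.partitions

proposition7p2 : (m n : ℕ) → 3 ≤ m → m % 2 ≡ 1 → 6 ≤ n → n % 2 ≡ 0 →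
    (s : SeqChoice) →
      (Σ (Fin (2 ^ m) → Graph) λ Ks →
          (∀ t → AdmPathPartition m n (seqA m n s) (Ks t))
          × (∀ t t' → t ≢ t' → ¬ SameGraph m n (Ks t) (Ks t')))
      × (∀ K → AdmPathPartition m n (seqA m n s) K →
          Σ (Fin ((m ∸ 1) !) → Labeling) λ Xs →
            (∀ t → C4FaceMagicKBLabeling m n (Xs t)
                   × SameGraph m n (LGraph m n (Xs t)) K)
            × (∀ t t' → t ≢ t' → ¬ KBEquivalent m n (Xs t) (Xs t')))
proposition7p2 m n m≥3 m-odd n≥6 n-even s =
  Sequences.partitions m n m≥3 m-odd n≥6 n-even s ,
  Labelings.labelings m n m≥3 m-odd n≥6 n-even (seqA m n s)
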